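{- For every maximal configuration $x_0$ of $[\![C]\!]$, if $x_0$ has a covering chain $\emptyset\subset x_1\subset\cdots\subset x_n=x_0$ whose sequence of added events (read through their labels) is the word $\omega_0$, then $C \twoheadrightarrow v(x_0)\cdot(\omega_0,\checkmark) + \sum_k p_k\cdot(\omega_k, C_k)$ for some $\omega_k, p_k, C_k$, where $v$ is the configuration-valuation of $[\![C]\!]$.
   Context: Commands: $C ::= \mathtt{skip} \mid a\in Act \mid C;C \mid C \oplus_p C \mid C\parallel C$ with $p\in(0,1)$. Labels are $Act\cup\{sk\}\cup\{\tau\}$ ($\tau$ an invisible step). Small steps go from a command to a finite probability distribution over pairs (label, command or $\checkmark$): $\mathtt{skip}\to 1\cdot(sk,\checkmark)$, $a\to 1\cdot(a,\checkmark)$, $C_1\oplus_p C_2\to p\cdot(\tau,C_1)+(1-p)\cdot(\tau,C_2)$; for $C_1;C_2$: if $C_1\to1\cdot(l,\checkmark)$ then $C_1;C_2\to1\cdot(l,C_2)$, if $C_1\to 1\cdot(l,C_1')$ then $C_1;C_2\to 1\cdot(l,C_1';C_2)$, if $C_1\to\sum_i p_i(\tau,C_i)$ then $C_1;C_2\to\sum_i p_i(\tau,C_i;C_2)$; $C_1\parallel C_2$ analogously lets either side move (a side that reaches $\checkmark$ is removed). The multi-step relation: if $C\to\sum_i p_i(l,C_i)$ then $C\twoheadrightarrow\sum_i p_i(l,C_i)$; and if moreover each $C_i\twoheadrightarrow\sum_j p_j(\omega_{ij},C_{ij})$ then $C\twoheadrightarrow\sum_i p_i\sum_j p_j(l:\omega_{ij},C_{ij})$.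 A probabilistic event structure is an event structure $(E,\le,\#)$ (partial order with finite down-closures, hereditary irreflexive symmetric conflict; configurations are conflict-free down-closed sets) with a valuation $v$ on finite configurations, $v(\emptyset)=1$, satisfying $v(y)-\sum_{\emptyset\ne I\subseteq\{1..n\}}(-1)^{|I|+1}v(\bigcup_{i\in I}x_i)\ge0$ for $y\subseteq x_1,\dots,x_n$ ($v=0$ on non-configurations). Interpretation $[\![C]\!]$: $[\![\mathtt{skip}]\!]$, $[\![a]\!]$ are one-event structures with valuation 1; $[\![C_1;C_2]\!]$ has events $E_1\uplus(E_2\times$ maximal configurations of $[\![C_1]\!])$ with $e_1\le(e_2,x)$ for $e_1\in x$, and $v(x)=v_1(x)$ on configurations of $[\![C_1]\!]$, $v(x_1\cup(x_2\times\{x_1\}))=v_1(x_1)v_2(x_2)$; $[\![C_1\oplus_p C_2]\!]$ adds an initial event $\tau$ below everything, puts all events of the two sides in mutual conflict, and $v(x)=p\,v_1(x\setminus\tau)$ or $(1-p)v_2(x\setminus\tau)$, with $v(\emptyset)=v(\{\tau\})=1$; $[\![C_1\parallel C_2]\!]$ is the disjoint union with $v(x)=v_1(x\cap E_1)v_2(x\cap E_2)$. A covering chain of $x$ is a chain $\emptyset\subset x_1\subset\cdots\subset x_n=x$ of configurations each adding one event; events carry labels.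
   Formalization: The probabilities p of the choices $C_1\oplus_p C_2$ range over the rationals in (0,1), so the valuation v takes rational values. -}

module Defs where

open import Data.Bool using (Bool; true; false; _∧_; _∨_; not; if_then_else_; T)
open import Data.Nat using (ℕ; zero; suc; _+_; _*_)
open import Data.Fin using (Fin; zero; suc; _↑ˡ_; _↑ʳ_; splitAt; remQuot; combine)
open import Data.Fin.Subset using (Subset; ⁅_⁆; _∪_) renaming (⊥ to ∅ₛ)
open import Data.Vec using (Vec; []; _∷_; lookup; tabulate)
open import Data.List using (List; []; _∷_; map; _++_; concat; filter; length; take; foldr; allFin)
import Data.List as L
open import Data.Maybe using (Maybe; just; nothing)
open import Data.Product using (_×_; _,_; Σ)
open import Data.Sum using (_⊎_; inj₁; inj₂)
open import Data.Rational using (ℚ; 0ℚ; 1ℚ; _<_) renaming (_*_ to _*ℚ_; _-_ to _-ℚ_)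
open import Data.List.Relation.Unary.Unique.Propositional using (Unique)
open import Relation.Binary.PropositionalEquality using (_≡_)
open import Relation.Nullary.Decidable using (⌊_⌋)
open import Data.Bool.Properties using (T?)

data Label (Act : Set) : Set where
  act : Act → Label Act
  sk  : Label Act
  τ   : Label Act

-- Commands.  The probability p of a choice is a rational with 0 < p < 1
-- (the bounds are irrelevant arguments, so they do not affect equality).
data Cmd (Act : Set) : Set where
  skip   : Cmd Act
  act    : Act → Cmd Act
  _⨾_    : Cmd Act → Cmd Act → Cmd Act
  choice : Cmd Act → (p : ℚ) → .(0ℚ < p) → .(p < 1ℚ) → Cmd Act → Cmd Act
  _∥_    : Cmd Act → Cmd Act → Cmd Act

data Target (Act : Set) : Set where
  ✓   : Target Act
  cmd : Cmd Act → Target Act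

-- Finite (formal) probability distributions over pairs (label-thing, target),
-- represented as formal sums: lists of weighted atoms.
Dist : Set → Set → Set
Dist Act L = List (ℚ × L × Target Act)

τsplit : ∀ {Act} → List (ℚ × Cmd Act) → Dist Act (Label Act)
τsplit ps = map (λ { (p , c) → (p , τ , cmd c) }) ps

data _⟶_ {Act : Set} : Cmd Act → Dist Act (Label Act) → Set where
  skip-step : skip ⟶ ((1ℚ , sk , ✓) ∷ [])
  act-step  : ∀ {a} → act a ⟶ ((1ℚ , act a , ✓) ∷ [])
  choice-step : ∀ {C₁ C₂ p} .{h₁ : 0ℚ < p} .{h₂ : p < 1ℚ} →
    choice C₁ p h₁ h₂ C₂ ⟶ ((p , τ , cmd C₁) ∷ (1ℚ -ℚ p , τ , cmd C₂) ∷ [])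
  seq-done : ∀ {C₁ C₂ l} → C₁ ⟶ ((1ℚ , l , ✓) ∷ []) →
    (C₁ ⨾ C₂) ⟶ ((1ℚ , l , cmd C₂) ∷ [])
  seq-one  : ∀ {C₁ C₁′ C₂ l} → C₁ ⟶ ((1ℚ , l , cmd C₁′) ∷ []) →
    (C₁ ⨾ C₂) ⟶ ((1ℚ , l , cmd (C₁′ ⨾ C₂)) ∷ [])
  seq-τ    : ∀ {C₁ C₂} (ps : List (ℚ × Cmd Act)) → C₁ ⟶ τsplit ps →
    (C₁ ⨾ C₂) ⟶ τsplit (map (λ { (p , c) → (p , (c ⨾ C₂)) }) ps)
  parL-done : ∀ {C₁ C₂ l} → C₁ ⟶ ((1ℚ , l , ✓) ∷ []) →
    (C₁ ∥ C₂) ⟶ ((1ℚ , l , cmd C₂) ∷ [])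
  parL-one  : ∀ {C₁ C₁′ C₂ l} → C₁ ⟶ ((1ℚ , l , cmd C₁′) ∷ []) →
    (C₁ ∥ C₂) ⟶ ((1ℚ , l , cmd (C₁′ ∥ C₂)) ∷ [])
  parL-τ    : ∀ {C₁ C₂} (ps : List (ℚ × Cmd Act)) → C₁ ⟶ τsplit ps →
    (C₁ ∥ C₂) ⟶ τsplit (map (λ { (p , c) → (p , (c ∥ C₂)) }) ps)
  parR-done : ∀ {C₁ C₂ l} → C₂ ⟶ ((1ℚ , l , ✓) ∷ []) →
    (C₁ ∥ C₂) ⟶ ((1ℚ , l , cmd C₁) ∷ [])
  parR-one  : ∀ {C₁ C₂ C₂′ l} → C₂ ⟶ ((1ℚ , l , cmd C₂′) ∷ []) →
    (C₁ ∥ C₂) ⟶ ((1ℚ , l , cmd (C₁ ∥ C₂′)) ∷ [])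
  parR-τ    : ∀ {C₁ C₂} (ps : List (ℚ × Cmd Act)) → C₂ ⟶ τsplit ps →
    (C₁ ∥ C₂) ⟶ τsplit (map (λ { (p , c) → (p , (C₁ ∥ c)) }) ps)

Word : Set → Set
Word Act = List (Label Act)

labelled : ∀ {Act} → Label Act → List (ℚ × Cmd Act) → Dist Act (Label Act)
labelled l ps = map (λ { (p , c) → (p , l , cmd c) }) ps

scale : ∀ {Act} → ℚ → Label Act → Dist Act (Word Act) → Dist Act (Word Act)
scale p l d = map (λ { (q , ω , t) → (p *ℚ q , l ∷ ω , t) }) d

mutual
  data _↠_ {Act : Set} : Cmd Act → Dist Act (Word Act) → Set where
    ↠-step : ∀ {C d} → C ⟶ d →
      C ↠ map (λ { (p , l , t) → (p , l ∷ [] , t) }) d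
    ↠-more : ∀ {C l} (ps : List (ℚ × Cmd Act)) → C ⟶ labelled l ps →
      (ks : Conts l ps) → C ↠ combineConts ks

  data Conts {Act : Set} (l : Label Act) : List (ℚ × Cmd Act) → Set where
    []  : Conts l []
    _∷_ : ∀ {p C ps d} → C ↠ d → Conts l ps → Conts l ((p , C) ∷ ps)

  combineConts : ∀ {Act} {l : Label Act} {ps} → Conts l ps → Dist Act (Word Act)
  combineConts [] = []
  combineConts {l = l} {(p , _) ∷ _} (_∷_ {d = d} _ ks) = scale p l d ++ combineConts ks

-- Finite probabilistic event structures (events are Fin size;
-- order, conflict decidable; configurations are subsets)

record PES (Act : Set) : Set where
  field
    size : ℕ
    leq  : Fin size → Fin size → Bool
    cf   : Fin size → Fin size → Bool
    lab  : Fin size → Label Act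
    val  : Subset size → ℚ
open PES public

allL : ∀ {A : Set} → (A → Bool) → List A → Bool
allL f = foldr (λ a b → f a ∧ b) true

anyL : ∀ {A : Set} → (A → Bool) → List A → Bool
anyL f = foldr (λ a b → f a ∨ b) false

allB : ∀ {n} → (Fin n → Bool) → Bool
allB f = allL f (allFin _)

anyB : ∀ {n} → (Fin n → Bool) → Bool
anyB f = anyL f (allFin _)

_⇒B_ : Bool → Bool → Bool
a ⇒B b = not a ∨ b

allSubsets : ∀ n → List (Subset n)
allSubsets zero = [] ∷ []
allSubsets (suc n) = map (true ∷_) (allSubsets n) ++ map (false ∷_) (allSubsets n)

strictSubB : ∀ {n} → Subset n → Subset n → Bool
strictSubB x y = allB (λ i → lookup x i ⇒B lookup y i) ∧ anyB (λ i → lookup y i ∧ not (lookup x i))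

isConfigB : ∀ {Act} (P : PES Act) → Subset (size P) → Bool
isConfigB P x = allB λ i → allB λ j →
  ((lookup x j ∧ leq P i j) ⇒B lookup x i) ∧ ((lookup x i ∧ lookup x j) ⇒B not (cf P i j))

isMaximalB : ∀ {Act} (P : PES Act) → Subset (size P) → Bool
isMaximalB P x = isConfigB P x ∧ allL (λ y → not (isConfigB P y ∧ strictSubB x y)) (allSubsets (size P))

IsConfig : ∀ {Act} (P : PES Act) → Subset (size P) → Set
IsConfig P x = T (isConfigB P x)

IsMaximal : ∀ {Act} (P : PES Act) → Subset (size P) → Set
IsMaximal P x = T (isMaximalB P x)

maxConfigs : ∀ {Act} (P : PES Act) → List (Subset (size P))
maxConfigs P = filter (λ x → T? (isMaximalB P x)) (allSubsets (size P))

nonEmptyB : ∀ {n} → Subset n → Bool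
nonEmptyB x = anyB (lookup x)

toSubset : ∀ {n} → List (Fin n) → Subset n
toSubset = foldr (λ e s → ⁅ e ⁆ ∪ s) ∅ₛ

-- A covering chain ∅ ⊂ x₁ ⊂ … ⊂ xₙ = x, given by the sequence of added
-- events e₁ … eₙ (xᵢ = {e₁,…,eᵢ}); each xᵢ is a configuration and each step
-- adds exactly one new event.
CoveringChain : ∀ {Act} (P : PES Act) → Subset (size P) → List (Fin (size P)) → Set
CoveringChain P x es =
  Unique es × (∀ i → IsConfig P (toSubset (take i es))) × toSubset es ≡ x

restrictˡ : ∀ {m n} → Subset (m + n) → Subset m
restrictˡ {m} {n} x = tabulate (λ i → lookup x (i ↑ˡ n))

restrictʳ : ∀ {m n} → Subset (m + n) → Subset n
restrictʳ {m} x = tabulate (λ i → lookup x (m ↑ʳ i))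

firstJust : ∀ {k} {A : Set} → (Fin k → Maybe A) → Maybe A
firstJust {zero} f = nothing
firstJust {suc k} f with f zero
... | just a = just a
... | nothing = firstJust (λ i → f (suc i))

single : ∀ {Act} → Label Act → PES Act
single l = record { size = 1 ; leq = λ _ _ → true ; cf = λ _ _ → false
                  ; lab = λ _ → l ; val = λ _ → 1ℚ }

-- ⟦C₁ ; C₂⟧ : events E₁ ⊎ (maxconfigs(⟦C₁⟧) × E₂), encoded in Fin (n₁ + k * n₂)
seqPES : ∀ {Act} → PES Act → PES Act → PES Act
seqPES {Act} P₁ P₂ = P
  where
  n₁ = size P₁
  n₂ = size P₂
  k = length (maxConfigs P₁)
  mc : Fin k → Subset n₁
  mc j = L.lookup (maxConfigs P₁) j
  N = n₁ + k * n₂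
  dec : Fin N → Fin n₁ ⊎ (Fin k × Fin n₂)
  dec i with splitAt n₁ i
  ... | inj₁ e = inj₁ e
  ... | inj₂ r = inj₂ (remQuot n₂ r)
  sameIdx : Fin k → Fin k → Bool
  sameIdx j j' = ⌊ Data.Fin._≟_ j j' ⌋
  le : Fin N → Fin N → Bool
  le a b with dec a | dec b
  ... | inj₁ e | inj₁ e' = leq P₁ e e'
  ... | inj₁ e | inj₂ (j , _) = lookup (mc j) e
  ... | inj₂ _ | inj₁ _ = false
  ... | inj₂ (j , e) | inj₂ (j' , e') = sameIdx j j' ∧ leq P₂ e e'
  cfE1 : Fin n₁ → Fin k → Bool
  cfE1 e j = anyB (λ e' → lookup (mc j) e' ∧ cf P₁ e e')
  c : Fin N → Fin N → Bool
  c a b with dec a | dec b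
  ... | inj₁ e | inj₁ e' = cf P₁ e e'
  ... | inj₁ e | inj₂ (j , _) = cfE1 e j
  ... | inj₂ (j , _) | inj₁ e = cfE1 e j
  ... | inj₂ (j , e) | inj₂ (j' , e') = if sameIdx j j' then cf P₂ e e' else true
  lb : Fin N → Label Act
  lb a with dec a
  ... | inj₁ e = lab P₁ e
  ... | inj₂ (_ , e) = lab P₂ e
  part₂ : Subset N → Fin k → Subset n₂
  part₂ x j = tabulate (λ e → lookup x (n₁ ↑ʳ combine j e))
  P₀ : PES Act
  P₀ = record { size = N ; leq = le ; cf = c ; lab = lb ; val = λ _ → 0ℚ }
  v : Subset N → ℚ
  v x = if isConfigB P₀ x then
          (Data.Maybe.maybe (λ j → val P₁ (restrictˡ x) *ℚ val P₂ (part₂ x j))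
                            (val P₁ (restrictˡ x))
                            (firstJust (λ j → if nonEmptyB (part₂ x j) then just j else nothing)))
        else 0ℚ
  P : PES Act
  P = record { size = N ; leq = le ; cf = c ; lab = lb ; val = v }

-- ⟦C₁ ⊕ₚ C₂⟧ : events τ ⊎ E₁ ⊎ E₂, encoded in Fin (suc (n₁ + n₂)), zero = τ
choicePES : ∀ {Act} → ℚ → PES Act → PES Act → PES Act
choicePES {Act} p P₁ P₂ = P
  where
  n₁ = size P₁
  n₂ = size P₂
  N = suc (n₁ + n₂)
  le : Fin N → Fin N → Bool
  le zero _ = true
  le (suc _) zero = false
  le (suc a) (suc b) with splitAt n₁ a | splitAt n₁ b
  ... | inj₁ e | inj₁ e' = leq P₁ e e'
  ... | inj₂ e | inj₂ e' = leq P₂ e e'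
  ... | _ | _ = false
  c : Fin N → Fin N → Bool
  c zero _ = false
  c (suc _) zero = false
  c (suc a) (suc b) with splitAt n₁ a | splitAt n₁ b
  ... | inj₁ e | inj₁ e' = cf P₁ e e'
  ... | inj₂ e | inj₂ e' = cf P₂ e e'
  ... | _ | _ = true
  lb : Fin N → Label Act
  lb zero = τ
  lb (suc a) with splitAt n₁ a
  ... | inj₁ e = lab P₁ e
  ... | inj₂ e = lab P₂ e
  P₀ : PES Act
  P₀ = record { size = N ; leq = le ; cf = c ; lab = lb ; val = λ _ → 0ℚ }
  v : Subset N → ℚ
  v x with isConfigB P₀ x | x
  ... | false | _ = 0ℚ
  ... | true | false ∷ _ = 1ℚ          -- x = ∅
  ... | true | true ∷ r =
    if nonEmptyB (restrictʳ {n₁} r) then (1ℚ -ℚ p) *ℚ val P₂ (restrictʳ {n₁} r)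
    else if nonEmptyB (restrictˡ {n₁} r) then p *ℚ val P₁ (restrictˡ {n₁} r)
    else 1ℚ                            -- x = {τ}
  P : PES Act
  P = record { size = N ; leq = le ; cf = c ; lab = lb ; val = v }

parPES : ∀ {Act} → PES Act → PES Act → PES Act
parPES {Act} P₁ P₂ = P
  where
  n₁ = size P₁
  n₂ = size P₂
  N = n₁ + n₂
  le : Fin N → Fin N → Bool
  le a b with splitAt n₁ a | splitAt n₁ b
  ... | inj₁ e | inj₁ e' = leq P₁ e e'
  ... | inj₂ e | inj₂ e' = leq P₂ e e'
  ... | _ | _ = false
  c : Fin N → Fin N → Bool
  c a b with splitAt n₁ a | splitAt n₁ b
  ... | inj₁ e | inj₁ e' = cf P₁ e e'
  ... | inj₂ e | inj₂ e' = cf P₂ e e'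
  ... | _ | _ = false
  lb : Fin N → Label Act
  lb a with splitAt n₁ a
  ... | inj₁ e = lab P₁ e
  ... | inj₂ e = lab P₂ e
  P : PES Act
  P = record { size = N ; leq = le ; cf = c ; lab = lb
             ; val = λ x → val P₁ (restrictˡ {n₁} x) *ℚ val P₂ (restrictʳ {n₁} x) }

⟦_⟧ : ∀ {Act} → Cmd Act → PES Act
⟦ skip ⟧ = single sk
⟦ act a ⟧ = single (act a)
⟦ C₁ ⨾ C₂ ⟧ = seqPES ⟦ C₁ ⟧ ⟦ C₂ ⟧
⟦ choice C₁ p _ _ C₂ ⟧ = choicePES p ⟦ C₁ ⟧ ⟦ C₂ ⟧
⟦ C₁ ∥ C₂ ⟧ = parPES ⟦ C₁ ⟧ ⟦ C₂ ⟧

-- By induction on C, every covering chain of a maximal configuration x of ⟦ C ⟧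
-- is traced by a single run of C: a branch of its small steps whose
-- probabilities multiply to v(x) and whose labels spell the chain's word.  For
-- C₁ ∥ C₂ the chain splits into chains of the two components, whose words
-- interleave, and v is multiplicative.  For C₁ ⊕ₚ C₂ the chain starts with the
-- initial τ and then stays inside one branch, since the branches are in
-- conflict.  For C₁ ⨾ C₂ the chain must leave ⟦ C₁ ⟧.  If e₀ is its first event
-- in a copy of ⟦ C₂ ⟧, say the copy above the maximal configuration m of ⟦ C₁ ⟧,
-- every later event lies in that copy: other copies conflict with e₀, and an
-- event of ⟦ C₁ ⟧ after e₀ would lie in m, hence below e₀.  So the chain is a
-- chain of m followed by a chain of ⟦ C₂ ⟧.  Finally a run extends to a
-- multi-step derivation whose distribution contains its atom, by continuing all
-- other branches arbitrarily.

module Submission where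

open import Defs
open import Data.Bool using (Bool; true; false; _∧_; _∨_; not; if_then_else_; T)
open import Data.Bool.Properties using (∧-conicalˡ; ∧-conicalʳ; not-injective; T-≡; T?)
open import Data.Nat using (ℕ; zero; suc; _+_; _*_)
open import Data.Fin using (Fin; zero; suc; _↑ˡ_; _↑ʳ_; splitAt; join; combine; remQuot; quotRem; _≟_)
open import Data.Fin.Properties using (splitAt-↑ˡ; splitAt-↑ʳ; join-splitAt; remQuot-combine; combine-remQuot; suc-injective)
open import Data.Fin.Subset using (Subset; ⁅_⁆)
open import Data.Vec using (Vec; []; _∷_; lookup; tabulate; tail)
open import Data.Vec.Properties using (lookup-zipWith; lookup-replicate; lookup∘tabulate; tabulate∘lookup; tabulate-cong)
import Data.List as List
open import Data.List using (List; []; _∷_; map; _++_; take; length; allFin; mapMaybe)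
open import Data.List.Properties using (map-∘; map-cong; map-++; ++-identityʳ; mapMaybe-++; mapMaybe-map-retract)
open import Data.List.Membership.Propositional using (_∈_; _∉_)
open import Data.List.Membership.Propositional.Properties
  using (∈-map⁺; ∈-map⁻; ∈-++⁺ˡ; ∈-++⁺ʳ; ∈-++⁻; ∈-allFin; ∈-∃++; ∈-filter⁺; ∈-filter⁻; ∈-lookup)
open import Data.List.Relation.Unary.Any using (here; there; index)
open import Data.List.Relation.Unary.Any.Properties using (lookup-index)
open import Data.List.Relation.Unary.All as All using (All; []; _∷_)
open import Data.List.Relation.Unary.AllPairs using ([]; _∷_)
open import Data.List.Relation.Unary.Unique.Propositional using (Unique)
open import Data.List.Relation.Binary.Permutation.Propositional using (_↭_)
open import Data.List.Relation.Binary.Permutation.Propositional.Properties using (shift)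
open import Data.List.Relation.Ternary.Interleaving.Propositional using (Interleaving; []; consˡ; consʳ)
open import Data.Maybe using (Maybe; just; nothing)
open import Data.Product using (Σ; ∃; ∃₂; _×_; _,_; proj₁; proj₂; uncurry)
open import Data.Sum using (_⊎_; inj₁; inj₂; [_,_]′)
open import Data.Empty using (⊥; ⊥-elim)
open import Data.Rational using (ℚ; 1ℚ; _-_) renaming (_*_ to _*ℚ_)
open import Data.Rational.Properties using (*-assoc; *-comm; *-identityˡ; *-identityʳ)
open import Function using (_∘_)
open import Function.Bundles using (Equivalence)
open import Relation.Nullary using (¬_; yes; no)
open import Relation.Nullary.Decidable using (⌊_⌋)
open import Relation.Binary.PropositionalEquality

private
  variable
    Act : Set
    n : ℕ

absurdᵇ : ∀ {A : Set} {b} → b ≡ true → b ≡ false → A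
absurdᵇ refl ()

∧-intro : ∀ {a b} → a ≡ true → b ≡ true → a ∧ b ≡ true
∧-intro refl refl = refl

⇒B-elim : ∀ a b c → ((a ∧ b) ⇒B c) ≡ true → a ≡ true → b ≡ true → c ≡ true
⇒B-elim true true c e refl refl = e

⇒B-intro : ∀ a b c → (a ≡ true → b ≡ true → c ≡ true) → ((a ∧ b) ⇒B c) ≡ true
⇒B-intro true true c f = f refl refl
⇒B-intro true false c f = refl
⇒B-intro false b c f = refl

allL⁻ : ∀ {A : Set} (f : A → Bool) {x} xs → allL f xs ≡ true → x ∈ xs → f x ≡ true
allL⁻ f (y ∷ xs) e (here refl) = ∧-conicalˡ _ _ e
allL⁻ f (y ∷ xs) e (there m) = allL⁻ f xs (∧-conicalʳ (f y) _ e) m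

allL⁺ : ∀ {A : Set} (f : A → Bool) xs → (∀ x → f x ≡ true) → allL f xs ≡ true
allL⁺ f [] h = refl
allL⁺ f (y ∷ xs) h = ∧-intro (h y) (allL⁺ f xs h)

anyL⁺ : ∀ {A : Set} (f : A → Bool) {x} xs → f x ≡ true → x ∈ xs → anyL f xs ≡ true
anyL⁺ f (y ∷ xs) e (here refl) rewrite e = refl
anyL⁺ f (y ∷ xs) e (there m) with f y
... | true = refl
... | false = anyL⁺ f xs e m

anyL-false⁻ : ∀ {A : Set} (f : A → Bool) {x} xs → anyL f xs ≡ false → x ∈ xs → f x ≡ false
anyL-false⁻ f (y ∷ xs) e m with f y in fy
anyL-false⁻ f (y ∷ xs) e (here refl) | false = fy
anyL-false⁻ f (y ∷ xs) e (there m) | false = anyL-false⁻ f xs e m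

anyL-false⁺ : ∀ {A : Set} (f : A → Bool) xs → (∀ x → f x ≡ false) → anyL f xs ≡ false
anyL-false⁺ f [] h = refl
anyL-false⁺ f (y ∷ xs) h rewrite h y = anyL-false⁺ f xs h

allB⁻ : (f : Fin n → Bool) → allB f ≡ true → ∀ i → f i ≡ true
allB⁻ f e i = allL⁻ f (allFin _) e (∈-allFin i)

allB⁺ : (f : Fin n → Bool) → (∀ i → f i ≡ true) → allB f ≡ true
allB⁺ f = allL⁺ f (allFin _)

anyB⁺ : (f : Fin n → Bool) (i : Fin n) → f i ≡ true → anyB f ≡ true
anyB⁺ f i e = anyL⁺ f (allFin _) e (∈-allFin i)

anyB-false⁻ : (f : Fin n → Bool) → anyB f ≡ false → ∀ i → f i ≡ false
anyB-false⁻ f e i = anyL-false⁻ f (allFin _) e (∈-allFin i)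

anyB-false⁺ : (f : Fin n → Bool) → (∀ i → f i ≡ false) → anyB f ≡ false
anyB-false⁺ f = anyL-false⁺ f (allFin _)

tabulate-≗lookup : ∀ {A : Set} (f : Fin n → A) (v : Vec A n) → (∀ i → f i ≡ lookup v i) → tabulate f ≡ v
tabulate-≗lookup f v h = trans (tabulate-cong h) (tabulate∘lookup v)

≡true∷tail : (x : Vec Bool (suc n)) → lookup x zero ≡ true → x ≡ true ∷ tail x
≡true∷tail (true ∷ r) _ = refl

lookup-tail : ∀ {A : Set} (x : Vec A (suc n)) i → lookup (tail x) i ≡ lookup x (suc i)
lookup-tail (_ ∷ _) i = refl

-- Configurations, with subsets read as Boolean predicates

Pred : ℕ → Set
Pred n = Fin n → Bool

_⊆ᵖ_ : Pred n → Pred n → Set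
g ⊆ᵖ h = ∀ i → g i ≡ true → h i ≡ true

DownClosed : (P : PES Act) → Pred (size P) → Set
DownClosed P g = ∀ i j → g j ≡ true → leq P i j ≡ true → g i ≡ true

ConflictFree : (P : PES Act) → Pred (size P) → Set
ConflictFree P g = ∀ i j → g i ≡ true → g j ≡ true → cf P i j ≡ false

Config : (P : PES Act) → Pred (size P) → Set
Config P g = DownClosed P g × ConflictFree P g

Maximal : (P : PES Act) → Pred (size P) → Set
Maximal P g = Config P g × (∀ h → Config P h → g ⊆ᵖ h → h ⊆ᵖ g)

∅-Config : (Q : PES Act) → Config Q (λ _ → false)
∅-Config Q = (λ _ _ x _ → absurdᵇ x refl) , (λ _ _ x _ → absurdᵇ x refl)

Config-resp-≗ : (P : PES Act) {g h : Pred (size P)} → (∀ i → g i ≡ h i) → Config P g → Config P h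
Config-resp-≗ P eq (d , c) =
  (λ i j hj l → trans (sym (eq i)) (d i j (trans (eq j) hj) l)) ,
  (λ i j hi hj → c i j (trans (eq i) hi) (trans (eq j) hj))

Config-restrict : {P Q : PES Act} (emb : Fin (size Q) → Fin (size P)) →
  (∀ a a′ → leq P (emb a) (emb a′) ≡ leq Q a a′) → (∀ a a′ → cf P (emb a) (emb a′) ≡ cf Q a a′) →
  ∀ X → Config P X → Config Q (X ∘ emb)
Config-restrict emb leq-emb cf-emb X (d , c) =
    (λ a a′ xa′ l → d (emb a) (emb a′) xa′ (trans (leq-emb a a′) l))
  , (λ a a′ xa xa′ → trans (sym (cf-emb a a′)) (c (emb a) (emb a′) xa xa′))

isConfigB-sound : (P : PES Act) (x : Subset (size P)) → isConfigB P x ≡ true → Config P (lookup x)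
isConfigB-sound P x e =
    (λ i j xj l → ⇒B-elim (lookup x j) _ _ (∧-conicalˡ _ _ (row i j)) xj l)
  , (λ i j xi xj → not-injective (⇒B-elim (lookup x i) (lookup x j) _ (∧-conicalʳ _ _ (row i j)) xi xj))
  where
  row : ∀ i j → _
  row i j = allB⁻ _ (allB⁻ _ e i) j

isConfigB-complete : (P : PES Act) (x : Subset (size P)) → Config P (lookup x) → isConfigB P x ≡ true
isConfigB-complete P x (d , c) = allB⁺ _ λ i → allB⁺ _ λ j →
  ∧-intro (⇒B-intro (lookup x j) _ _ (d i j)) (⇒B-intro (lookup x i) (lookup x j) _ λ a b → cong not (c i j a b))

IsConfig→Config : (P : PES Act) (x : Subset (size P)) → IsConfig P x → Config P (lookup x)
IsConfig→Config P x t = isConfigB-sound P x (Equivalence.to T-≡ t)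

allSubsets-complete : ∀ n (y : Subset n) → y ∈ allSubsets n
allSubsets-complete zero [] = here refl
allSubsets-complete (suc n) (true ∷ y) = ∈-++⁺ˡ (∈-map⁺ _ (allSubsets-complete n y))
allSubsets-complete (suc n) (false ∷ y) = ∈-++⁺ʳ _ (∈-map⁺ _ (allSubsets-complete n y))

IsMaximal→Maximal : (P : PES Act) (x : Subset (size P)) → IsMaximal P x → Maximal P (lookup x)
IsMaximal→Maximal P x t = isConfigB-sound P x (∧-conicalˡ _ _ e) , maximality
  where
  e : isMaximalB P x ≡ true
  e = Equivalence.to T-≡ t
  maximality : ∀ h → Config P h → lookup x ⊆ᵖ h → h ⊆ᵖ lookup x
  maximality h ch sub i hi = x∋i
    where
    y = tabulate h
    h≗y : ∀ i → h i ≡ lookup y i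
    h≗y i = sym (lookup∘tabulate h i)
    y-config : isConfigB P y ≡ true
    y-config = isConfigB-complete P y (Config-resp-≗ P h≗y ch)
    not-above : not (isConfigB P y ∧ strictSubB x y) ≡ true
    not-above = allL⁻ _ _ (∧-conicalʳ (isConfigB P x) _ e) (allSubsets-complete _ y)
    x⊆y : allB (λ i → lookup x i ⇒B lookup y i) ≡ true
    x⊆y = allB⁺ _ λ j → x⊆y-at j
      where
      x⊆y-at : ∀ j → (lookup x j ⇒B lookup y j) ≡ true
      x⊆y-at j with lookup x j in xj
      ... | false = refl
      ... | true = trans (sym (h≗y j)) (sub j xj)
    y⊆x : anyB (λ i → lookup y i ∧ not (lookup x i)) ≡ false
    y⊆x with anyB (λ i → lookup y i ∧ not (lookup x i)) | not-above
    ... | false | _ = refl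
    ... | true | n rewrite y-config | x⊆y = absurdᵇ n refl
    x∋i : lookup x i ≡ true
    x∋i with lookup x i | anyB-false⁻ _ y⊆x i
    ... | true | _ = refl
    ... | false | r = absurdᵇ (cong (_∧ true) (trans (sym (h≗y i)) hi)) r

Maximal→isMaximalB : (P : PES Act) (x : Subset (size P)) → Maximal P (lookup x) → isMaximalB P x ≡ true
Maximal→isMaximalB P x (c , mx) = ∧-intro (isConfigB-complete P x c) (allL⁺ _ (allSubsets (size P)) no-strict-superset)
  where
  no-strict-superset : ∀ y → not (isConfigB P y ∧ strictSubB x y) ≡ true
  no-strict-superset y with isConfigB P y in cy
  ... | false = refl
  ... | true with allB (λ i → lookup x i ⇒B lookup y i) in x⊆y
  ... | false = refl
  ... | true = cong not (anyB-false⁺ (λ i → lookup y i ∧ not (lookup x i)) y⊆x)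
    where
    y⊆x : ∀ i → lookup y i ∧ not (lookup x i) ≡ false
    y⊆x i with lookup y i in yi
    ... | false = refl
    ... | true rewrite mx (lookup y) (isConfigB-sound P y cy)
                          (λ j xj → ⇒B-elim true (lookup x j) (lookup y j) (allB⁻ _ x⊆y j) refl xj) i yi = refl

member : List (Fin n) → Pred n
member es = lookup (toSubset es)

member-[] : (i : Fin n) → member [] i ≡ false
member-[] i = lookup-replicate i false

lookup-⁅⁆⁻ : (e i : Fin n) → lookup ⁅ e ⁆ i ≡ true → i ≡ e
lookup-⁅⁆⁻ zero zero _ = refl
lookup-⁅⁆⁻ zero (suc i) h = absurdᵇ h (member-[] i)
lookup-⁅⁆⁻ (suc e) (suc i) h = cong suc (lookup-⁅⁆⁻ e i h)

lookup-⁅⁆-self : (e : Fin n) → lookup ⁅ e ⁆ e ≡ true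
lookup-⁅⁆-self zero = refl
lookup-⁅⁆-self (suc e) = lookup-⁅⁆-self e

member-∷ : (e : Fin n) (ys : List (Fin n)) (i : Fin n) → member (e ∷ ys) i ≡ lookup ⁅ e ⁆ i ∨ member ys i
member-∷ e ys i = lookup-zipWith _∨_ i ⁅ e ⁆ (toSubset ys)

member⇒∈ : (ys : List (Fin n)) (i : Fin n) → member ys i ≡ true → i ∈ ys
member⇒∈ [] i h = absurdᵇ h (member-[] i)
member⇒∈ (e ∷ ys) i h with lookup ⁅ e ⁆ i in e∋i
... | true = here (lookup-⁅⁆⁻ e i e∋i)
... | false = there (member⇒∈ ys i (trans (sym (trans (member-∷ e ys i) (cong (_∨ member ys i) e∋i))) h))

∈⇒member : (ys : List (Fin n)) (i : Fin n) → i ∈ ys → member ys i ≡ true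
∈⇒member (e ∷ ys) i (here refl) rewrite member-∷ e ys e | lookup-⁅⁆-self e = refl
∈⇒member (e ∷ ys) i (there m) rewrite member-∷ e ys i | ∈⇒member ys i m with lookup ⁅ e ⁆ i
... | true = refl
... | false = refl

∉⇒member : (ys : List (Fin n)) (i : Fin n) → i ∉ ys → member ys i ≡ false
∉⇒member ys i i∉ys with member ys i in eq
... | true = ⊥-elim (i∉ys (member⇒∈ ys i eq))
... | false = refl

member-cong : ∀ {m} (ys : List (Fin n)) (zs : List (Fin m)) i j →
  (i ∈ ys → j ∈ zs) → (j ∈ zs → i ∈ ys) → member ys i ≡ member zs j
member-cong ys zs i j to from with member ys i in ys∋i | member zs j in zs∋j
... | true | true = refl
... | false | false = refl
... | true | false = absurdᵇ (∈⇒member zs j (to (member⇒∈ ys i ys∋i))) zs∋j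
... | false | true = absurdᵇ (∈⇒member ys i (from (member⇒∈ zs j zs∋j))) ys∋i

-- Covering chains of maximal configurations

MaximalChain : (P : PES Act) → List (Fin (size P)) → Set
MaximalChain P es = Unique es × (∀ i → Config P (member (take i es))) × Maximal P (member es)

mapMaybe-∷-just : ∀ {A B : Set} (f : A → Maybe B) {x y} ys → f x ≡ just y → mapMaybe f (x ∷ ys) ≡ y ∷ mapMaybe f ys
mapMaybe-∷-just f ys e rewrite e = refl

mapMaybe-∷-nothing : ∀ {A B : Set} (f : A → Maybe B) {x} ys → f x ≡ nothing → mapMaybe f (x ∷ ys) ≡ mapMaybe f ys
mapMaybe-∷-nothing f ys e rewrite e = refl

module PartialInverse {A B : Set} (proj : A → Maybe B) (emb : B → A)
    (proj-just : ∀ {a b} → proj a ≡ just b → a ≡ emb b) (proj-emb : ∀ b → proj (emb b) ≡ just b) where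

  ∈-mapMaybe⁻ : ∀ {b} ys → b ∈ mapMaybe proj ys → emb b ∈ ys
  ∈-mapMaybe⁻ (x ∷ xs) m with proj x in eq
  ∈-mapMaybe⁻ (x ∷ xs) (here refl) | just y = here (sym (proj-just eq))
  ∈-mapMaybe⁻ (x ∷ xs) (there m) | just y = there (∈-mapMaybe⁻ xs m)
  ∈-mapMaybe⁻ (x ∷ xs) m | nothing = there (∈-mapMaybe⁻ xs m)

  ∈-mapMaybe⁺ : ∀ {b} ys → emb b ∈ ys → b ∈ mapMaybe proj ys
  ∈-mapMaybe⁺ {b} (x ∷ xs) (here refl) rewrite proj-emb b = here refl
  ∈-mapMaybe⁺ (x ∷ xs) (there m) with proj x
  ... | just y = there (∈-mapMaybe⁺ xs m)
  ... | nothing = ∈-mapMaybe⁺ xs m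

  mapMaybe-unique : ∀ ys → Unique ys → Unique (mapMaybe proj ys)
  mapMaybe-unique [] u = []
  mapMaybe-unique (x ∷ xs) (x∉xs ∷ u) with proj x in eq
  ... | just y = All.tabulate (λ m y≡b → All.lookup x∉xs (∈-mapMaybe⁻ xs m) (trans (proj-just eq) (cong emb y≡b)))
                 ∷ mapMaybe-unique xs u
  ... | nothing = mapMaybe-unique xs u

  take-mapMaybe : ∀ i ys → ∃ λ k → take i (mapMaybe proj ys) ≡ mapMaybe proj (take k ys)
  take-mapMaybe zero ys = zero , refl
  take-mapMaybe (suc i) [] = zero , refl
  take-mapMaybe (suc i) (x ∷ xs) with proj x in eq
  ... | just y with take-mapMaybe i xs
  ...   | k , e = suc k , trans (cong (y ∷_) e) (sym (mapMaybe-∷-just proj (take k xs) eq))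
  take-mapMaybe (suc i) (x ∷ xs) | nothing with take-mapMaybe (suc i) xs
  ...   | k , e = suc k , trans e (sym (mapMaybe-∷-nothing proj (take k xs) eq))

  mapMaybe-map-emb : ∀ xs → mapMaybe proj (map emb xs) ≡ xs
  mapMaybe-map-emb = mapMaybe-map-retract {proj = proj} {emb = emb} proj-emb

  map-emb-mapMaybe : ∀ ys → All (λ y → ∃ λ b → y ≡ emb b) ys → ys ≡ map emb (mapMaybe proj ys)
  map-emb-mapMaybe [] [] = refl
  map-emb-mapMaybe (y ∷ ys) ((b , refl) ∷ a) rewrite proj-emb b = cong (emb b ∷_) (map-emb-mapMaybe ys a)

module Restriction {P Q : PES Act} (proj : Fin (size P) → Maybe (Fin (size Q))) (emb : Fin (size Q) → Fin (size P))
    (proj-just : ∀ {i a} → proj i ≡ just a → i ≡ emb a) (proj-emb : ∀ a → proj (emb a) ≡ just a) where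
  open PartialInverse proj emb proj-just proj-emb public

  member-mapMaybe : ∀ ys a → member (mapMaybe proj ys) a ≡ member ys (emb a)
  member-mapMaybe ys a = member-cong (mapMaybe proj ys) ys a (emb a) (∈-mapMaybe⁻ ys) (∈-mapMaybe⁺ ys)

  restrict-MaximalChain :
    (∀ X → Config P X → Config Q (X ∘ emb)) →
    ∀ es → (∀ h → Config Q h → member (mapMaybe proj es) ⊆ᵖ h →
              Σ (Pred (size P)) λ ĥ → Config P ĥ × (member es ⊆ᵖ ĥ) × (∀ a → ĥ (emb a) ≡ h a)) →
    MaximalChain P es → MaximalChain Q (mapMaybe proj es)
  restrict-MaximalChain restrict es extend (u , prefixes , (c , mx)) =
    mapMaybe-unique es u , prefixes′ , (restrict-member es c , mx′)
    where
    restrict-member : ∀ ys → Config P (member ys) → Config Q (member (mapMaybe proj ys))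
    restrict-member ys cy = Config-resp-≗ Q (λ a → sym (member-mapMaybe ys a)) (restrict (member ys) cy)
    prefixes′ : ∀ i → Config Q (member (take i (mapMaybe proj es)))
    prefixes′ i with take-mapMaybe i es
    ... | k , e rewrite e = restrict-member (take k es) (prefixes k)
    mx′ : ∀ h → Config Q h → member (mapMaybe proj es) ⊆ᵖ h → h ⊆ᵖ member (mapMaybe proj es)
    mx′ h ch sub a ha with extend h ch sub
    ... | ĥ , cĥ , es⊆ĥ , ĥ∘emb = trans (member-mapMaybe es a) (mx ĥ cĥ es⊆ĥ (emb a) (trans (ĥ∘emb a) ha))

map-lab-emb : {P Q : PES Act} (emb : Fin (size Q) → Fin (size P)) → (∀ a → lab P (emb a) ≡ lab Q a) →
  ∀ es → map (lab P) (map emb es) ≡ map (lab Q) es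
map-lab-emb {P = P} emb lab-emb es = trans (sym (map-∘ {g = lab P} {f = emb} es)) (map-cong lab-emb es)

module Sum (n₁ n₂ : ℕ) where
  L : Fin n₁ → Fin (n₁ + n₂)
  L a = a ↑ˡ n₂
  R : Fin n₂ → Fin (n₁ + n₂)
  R b = n₁ ↑ʳ b

  data View : Fin (n₁ + n₂) → Set where
    isL : ∀ a → View (L a)
    isR : ∀ b → View (R b)

  view : ∀ i → View i
  view i with splitAt n₁ i in eq
  ... | inj₁ a = subst View (trans (sym (cong (join n₁ n₂) eq)) (join-splitAt n₁ n₂ i)) (isL a)
  ... | inj₂ b = subst View (trans (sym (cong (join n₁ n₂) eq)) (join-splitAt n₁ n₂ i)) (isR b)

  splitAt-L : ∀ a → splitAt n₁ (L a) ≡ inj₁ a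
  splitAt-L a = splitAt-↑ˡ n₁ a n₂
  splitAt-R : ∀ b → splitAt n₁ (R b) ≡ inj₂ b
  splitAt-R b = splitAt-↑ʳ n₁ n₂ b

  L≢R : ∀ {a b} → L a ≡ R b → ∀ {X : Set} → X
  L≢R {a} {b} e with trans (sym (splitAt-L a)) (trans (cong (splitAt n₁) e) (splitAt-R b))
  ... | ()

  R-injective : ∀ {b b′} → R b ≡ R b′ → b ≡ b′
  R-injective {b} {b′} e with trans (sym (splitAt-R b)) (trans (cong (splitAt n₁) e) (splitAt-R b′))
  ... | refl = refl

  [_,_]ᶠ : ∀ {A : Set} → (Fin n₁ → A) → (Fin n₂ → A) → Fin (n₁ + n₂) → A
  [ f , g ]ᶠ i = [ f , g ]′ (splitAt n₁ i)

  [,]ᶠ-L : ∀ {A : Set} (f : Fin n₁ → A) g a → [ f , g ]ᶠ (L a) ≡ f a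
  [,]ᶠ-L f g a rewrite splitAt-L a = refl
  [,]ᶠ-R : ∀ {A : Set} (f : Fin n₁ → A) g b → [ f , g ]ᶠ (R b) ≡ g b
  [,]ᶠ-R f g b rewrite splitAt-R b = refl

  projˡ : Fin (n₁ + n₂) → Maybe (Fin n₁)
  projˡ = [ just , (λ _ → nothing) ]ᶠ
  projʳ : Fin (n₁ + n₂) → Maybe (Fin n₂)
  projʳ = [ (λ _ → nothing) , just ]ᶠ

  projˡ-L : ∀ a → projˡ (L a) ≡ just a
  projˡ-L = [,]ᶠ-L just _
  projˡ-R : ∀ b → projˡ (R b) ≡ nothing
  projˡ-R = [,]ᶠ-R just _
  projʳ-L : ∀ a → projʳ (L a) ≡ nothing
  projʳ-L = [,]ᶠ-L _ just
  projʳ-R : ∀ b → projʳ (R b) ≡ just b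
  projʳ-R = [,]ᶠ-R _ just

  projˡ-just : ∀ {i a} → projˡ i ≡ just a → i ≡ L a
  projˡ-just {i} e with view i
  ... | isL a′ rewrite projˡ-L a′ with e
  ... | refl = refl
  projˡ-just {i} e | isR b rewrite projˡ-R b with e
  ... | ()
  projʳ-just : ∀ {i b} → projʳ i ≡ just b → i ≡ R b
  projʳ-just {i} e with view i
  ... | isR b′ rewrite projʳ-R b′ with e
  ... | refl = refl
  projʳ-just {i} e | isL a rewrite projʳ-L a with e
  ... | ()

-- Runs

-- A single branch through the small steps of C, ending in ✓: v is the product
-- of the probabilities met along it and w its word of labels.
data Run {Act : Set} : Cmd Act → ℚ → Word Act → Set where
  halt : ∀ {C l} → C ⟶ ((1ℚ , l , ✓) ∷ []) → Run C 1ℚ (l ∷ [])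
  step : ∀ {C C′ l v w} → C ⟶ ((1ℚ , l , cmd C′) ∷ []) → Run C′ v w → Run C (1ℚ *ℚ v) (l ∷ w)
  branch : ∀ {C C′ v w p} ps → C ⟶ τsplit ps → (p , C′) ∈ ps → Run C′ v w → Run C (p *ℚ v) (τ ∷ w)

Realises : Cmd Act → PES Act → Set
Realises C P = ∀ es → MaximalChain P es → Run C (val P (toSubset es)) (map (lab P) es)

Run-resp-≡ : ∀ {C : Cmd Act} {v v′ w} → v ≡ v′ → Run C v w → Run C v′ w
Run-resp-≡ refl r = r

Run-nonempty : ∀ {C : Cmd Act} {v} → Run C v [] → ∀ {X : Set} → X
Run-nonempty ()

data StepShape {Act : Set} (C : Cmd Act) : Set where
  halts : ∀ l → C ⟶ ((1ℚ , l , ✓) ∷ []) → StepShape C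
  moves : ∀ l C′ → C ⟶ ((1ℚ , l , cmd C′) ∷ []) → StepShape C
  splits : ∀ ps → C ⟶ τsplit ps → StepShape C

stepShape : (C : Cmd Act) → StepShape C
stepShape skip = halts sk skip-step
stepShape (act a) = halts (act a) act-step
stepShape (choice C₁ p h₁ h₂ C₂) = splits ((p , C₁) ∷ (1ℚ - p , C₂) ∷ []) choice-step
stepShape (C₁ ⨾ C₂) with stepShape C₁
... | halts l s = moves l C₂ (seq-done s)
... | moves l C′ s = moves l (C′ ⨾ C₂) (seq-one s)
... | splits ps s = splits _ (seq-τ ps s)
stepShape (C₁ ∥ C₂) with stepShape C₁
... | halts l s = moves l C₂ (parL-done s)
... | moves l C′ s = moves l (C′ ∥ C₂) (parL-one s)
... | splits ps s = splits _ (parL-τ ps s)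

↠-total : (C : Cmd Act) → ∃ (C ↠_)
↠-total C with stepShape C
... | halts l s = _ , ↠-step s
... | moves l C′ s = _ , ↠-step s
... | splits ps s = _ , ↠-step s

τsplit≡labelled : (ps : List (ℚ × Cmd Act)) → τsplit ps ≡ labelled τ ps
τsplit≡labelled [] = refl
τsplit≡labelled ((p , c) ∷ ps) = cong (_ ∷_) (τsplit≡labelled ps)

Conts-through : ∀ {l : Label Act} (ps : List (ℚ × Cmd Act)) {p C′ v w d} →
  (p , C′) ∈ ps → C′ ↠ d → (v , w , ✓) ∈ d →
  Σ (Conts l ps) λ ks → (p *ℚ v , l ∷ w , ✓) ∈ combineConts ks
Conts-through ((p , C′) ∷ ps) (here refl) r m = (r ∷ arbitrary ps) , ∈-++⁺ˡ (∈-map⁺ _ m)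
  where
  arbitrary : ∀ {l} qs → Conts l qs
  arbitrary [] = []
  arbitrary ((_ , c) ∷ qs) = proj₂ (↠-total c) ∷ arbitrary qs
Conts-through ((q , c) ∷ ps) (there i) r m with Conts-through ps i r m
... | ks , m′ = (proj₂ (↠-total c) ∷ ks) , ∈-++⁺ʳ _ m′

Run⇒↠ : ∀ {C : Cmd Act} {v w} → Run C v w → ∃ λ d → (C ↠ d) × ((v , w , ✓) ∈ d)
Run⇒↠ (halt s) = _ , ↠-step s , here refl
Run⇒↠ (step {C′ = C′} s r) with Run⇒↠ r
... | d , r↠ , m = _ , ↠-more ((1ℚ , C′) ∷ []) s (r↠ ∷ []) , ∈-++⁺ˡ (∈-map⁺ _ m)
Run⇒↠ (branch ps s i r) with Run⇒↠ r
... | d , r↠ , m with Conts-through ps i r↠ m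
... | ks , m′ = _ , ↠-more ps (subst (_ ⟶_) (τsplit≡labelled ps) s) ks , m′

∈⇒↭-∷ : ∀ {A : Set} {x : A} {xs} → x ∈ xs → ∃ λ rest → xs ↭ (x ∷ rest)
∈⇒↭-∷ m with ∈-∃++ m
... | ys , zs , refl = _ , shift _ ys zs

*-assocˡ : ∀ a b c → a *ℚ (b *ℚ c) ≡ (a *ℚ b) *ℚ c
*-assocˡ a b c = sym (*-assoc a b c)

*-swapˡ : ∀ a b c → a *ℚ (b *ℚ c) ≡ b *ℚ (a *ℚ c)
*-swapˡ a b c = trans (*-assocˡ a b c) (trans (cong (_*ℚ c) (*-comm a b)) (*-assoc b a c))

Run-⨾ : ∀ {C₁ C₂ : Cmd Act} {v₁ v₂ w₁ w₂} → Run C₁ v₁ w₁ → Run C₂ v₂ w₂ →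
  Run (C₁ ⨾ C₂) (v₁ *ℚ v₂) (w₁ ++ w₂)
Run-⨾ (halt s) r₂ = step (seq-done s) r₂
Run-⨾ {v₂ = v₂} (step {v = v} s r₁) r₂ = Run-resp-≡ (*-assocˡ 1ℚ v v₂) (step (seq-one s) (Run-⨾ r₁ r₂))
Run-⨾ {v₂ = v₂} (branch {v = v} {p = p} ps s i r₁) r₂ =
  Run-resp-≡ (*-assocˡ p v v₂) (branch _ (seq-τ ps s) (∈-map⁺ _ i) (Run-⨾ r₁ r₂))

Interleaving-[]ˡ : ∀ {A : Set} {ys zs : List A} → Interleaving [] ys zs → zs ≡ ys
Interleaving-[]ˡ [] = refl
Interleaving-[]ˡ (consʳ i) = cong (_ ∷_) (Interleaving-[]ˡ i)

Interleaving-[]ʳ : ∀ {A : Set} {xs zs : List A} → Interleaving xs [] zs → zs ≡ xs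
Interleaving-[]ʳ [] = refl
Interleaving-[]ʳ (consˡ i) = cong (_ ∷_) (Interleaving-[]ʳ i)

Run-∥ : ∀ {C₁ C₂ : Cmd Act} {v₁ v₂ w₁ w₂ w} → Run C₁ v₁ w₁ → Run C₂ v₂ w₂ →
  Interleaving w₁ w₂ w → Run (C₁ ∥ C₂) (v₁ *ℚ v₂) w
Run-∥ (halt s) r₂ (consˡ i) rewrite Interleaving-[]ˡ i = step (parL-done s) r₂
Run-∥ {v₂ = v₂} (step {v = v} s r₁) r₂ (consˡ i) =
  Run-resp-≡ (*-assocˡ 1ℚ v v₂) (step (parL-one s) (Run-∥ r₁ r₂ i))
Run-∥ {v₂ = v₂} (branch {v = v} {p = p} ps s m r₁) r₂ (consˡ i) =
  Run-resp-≡ (*-assocˡ p v v₂) (branch _ (parL-τ ps s) (∈-map⁺ _ m) (Run-∥ r₁ r₂ i))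
Run-∥ {v₁ = v₁} r₁ (halt s) (consʳ i) rewrite Interleaving-[]ʳ i =
  Run-resp-≡ (trans (*-identityˡ v₁) (sym (*-identityʳ v₁))) (step (parR-done s) r₁)
Run-∥ {v₁ = v₁} r₁ (step {v = v} s r₂) (consʳ i) =
  Run-resp-≡ (*-swapˡ 1ℚ v₁ v) (step (parR-one s) (Run-∥ r₁ r₂ i))
Run-∥ {v₁ = v₁} r₁ (branch {v = v} {p = p} ps s m r₂) (consʳ i) =
  Run-resp-≡ (*-swapˡ p v₁ v) (branch _ (parR-τ ps s) (∈-map⁺ _ m) (Run-∥ r₁ r₂ i))

module Parallel {Act : Set} (P₁ P₂ : PES Act) where
  open Sum (size P₁) (size P₂)
  P = parPES P₁ P₂

  leq-LL : ∀ a a′ → leq P (L a) (L a′) ≡ leq P₁ a a′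
  leq-LL a a′ rewrite splitAt-L a | splitAt-L a′ = refl
  leq-RR : ∀ b b′ → leq P (R b) (R b′) ≡ leq P₂ b b′
  leq-RR b b′ rewrite splitAt-R b | splitAt-R b′ = refl
  leq-LR : ∀ a b → leq P (L a) (R b) ≡ false
  leq-LR a b rewrite splitAt-L a | splitAt-R b = refl
  leq-RL : ∀ a b → leq P (R b) (L a) ≡ false
  leq-RL a b rewrite splitAt-L a | splitAt-R b = refl
  cf-LL : ∀ a a′ → cf P (L a) (L a′) ≡ cf P₁ a a′
  cf-LL a a′ rewrite splitAt-L a | splitAt-L a′ = refl
  cf-RR : ∀ b b′ → cf P (R b) (R b′) ≡ cf P₂ b b′
  cf-RR b b′ rewrite splitAt-R b | splitAt-R b′ = refl
  cf-LR : ∀ a b → cf P (L a) (R b) ≡ false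
  cf-LR a b rewrite splitAt-L a | splitAt-R b = refl
  cf-RL : ∀ a b → cf P (R b) (L a) ≡ false
  cf-RL a b rewrite splitAt-L a | splitAt-R b = refl
  lab-L : ∀ a → lab P (L a) ≡ lab P₁ a
  lab-L a rewrite splitAt-L a = refl
  lab-R : ∀ b → lab P (R b) ≡ lab P₂ b
  lab-R b rewrite splitAt-R b = refl

  [,]ᶠ-Config : ∀ {A B} → Config P₁ A → Config P₂ B → Config P [ A , B ]ᶠ
  [,]ᶠ-Config {A} {B} (d₁ , c₁) (d₂ , c₂) = down , free
    where
    down : DownClosed P [ A , B ]ᶠ
    down i j with view i | view j
    ... | isL a | isL a′ = λ x l → trans ([,]ᶠ-L A B a) (d₁ a a′ (trans (sym ([,]ᶠ-L A B a′)) x) (trans (sym (leq-LL a a′)) l))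
    ... | isR b | isR b′ = λ x l → trans ([,]ᶠ-R A B b) (d₂ b b′ (trans (sym ([,]ᶠ-R A B b′)) x) (trans (sym (leq-RR b b′)) l))
    ... | isL a | isR b′ = λ x l → absurdᵇ l (leq-LR a b′)
    ... | isR b | isL a′ = λ x l → absurdᵇ l (leq-RL a′ b)
    free : ConflictFree P [ A , B ]ᶠ
    free i j with view i | view j
    ... | isL a | isL a′ = λ x y → trans (cf-LL a a′) (c₁ a a′ (trans (sym ([,]ᶠ-L A B a)) x) (trans (sym ([,]ᶠ-L A B a′)) y))
    ... | isR b | isR b′ = λ x y → trans (cf-RR b b′) (c₂ b b′ (trans (sym ([,]ᶠ-R A B b)) x) (trans (sym ([,]ᶠ-R A B b′)) y))
    ... | isL a | isR b′ = λ _ _ → cf-LR a b′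
    ... | isR b | isL a′ = λ _ _ → cf-RL a′ b

  module Left = Restriction {P = P} {Q = P₁} projˡ L projˡ-just projˡ-L
  module Right = Restriction {P = P} {Q = P₂} projʳ R projʳ-just projʳ-R

  restrict-L : ∀ X → Config P X → Config P₁ (λ a → X (L a))
  restrict-L = Config-restrict {P = P} {Q = P₁} L leq-LL cf-LL

  restrict-R : ∀ X → Config P X → Config P₂ (λ b → X (R b))
  restrict-R = Config-restrict {P = P} {Q = P₂} R leq-RR cf-RR

  lefts : List (Fin (size P)) → List (Fin (size P₁))
  lefts = mapMaybe projˡ
  rights : List (Fin (size P)) → List (Fin (size P₂))
  rights = mapMaybe projʳ

  lefts-MaximalChain : ∀ es → MaximalChain P es → MaximalChain P₁ (lefts es)
  lefts-MaximalChain es chain@(_ , _ , (c , _)) =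
    Left.restrict-MaximalChain restrict-L es extend chain
    where
    extend : ∀ h → Config P₁ h → member (lefts es) ⊆ᵖ h → _
    extend h ch sub = [ h , (λ b → member es (R b)) ]ᶠ , [,]ᶠ-Config ch (restrict-R (member es) c) , es⊆ , [,]ᶠ-L h _
      where
      es⊆ : member es ⊆ᵖ [ h , (λ b → member es (R b)) ]ᶠ
      es⊆ i x with view i
      ... | isL a = trans ([,]ᶠ-L h _ a) (sub a (trans (Left.member-mapMaybe es a) x))
      ... | isR b = trans ([,]ᶠ-R h _ b) x

  rights-MaximalChain : ∀ es → MaximalChain P es → MaximalChain P₂ (rights es)
  rights-MaximalChain es chain@(_ , _ , (c , _)) =
    Right.restrict-MaximalChain restrict-R es extend chain
    where
    extend : ∀ h → Config P₂ h → member (rights es) ⊆ᵖ h → _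
    extend h ch sub = [ (λ a → member es (L a)) , h ]ᶠ , [,]ᶠ-Config (restrict-L (member es) c) ch , es⊆ , [,]ᶠ-R _ h
      where
      es⊆ : member es ⊆ᵖ [ (λ a → member es (L a)) , h ]ᶠ
      es⊆ i x with view i
      ... | isL a = trans ([,]ᶠ-L _ h a) x
      ... | isR b = trans ([,]ᶠ-R _ h b) (sub b (trans (Right.member-mapMaybe es b) x))

  labels-interleave : ∀ es → Interleaving (map (lab P₁) (lefts es)) (map (lab P₂) (rights es)) (map (lab P) es)
  labels-interleave [] = []
  labels-interleave (i ∷ es) with view i
  ... | isL a rewrite mapMaybe-∷-just projˡ es (projˡ-L a) | mapMaybe-∷-nothing projʳ es (projʳ-L a) | lab-L a =
    consˡ (labels-interleave es)
  ... | isR b rewrite mapMaybe-∷-nothing projˡ es (projˡ-R b) | mapMaybe-∷-just projʳ es (projʳ-R b) | lab-R b =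
    consʳ (labels-interleave es)

  val-lefts-rights : ∀ es → val P (toSubset es) ≡ val P₁ (toSubset (lefts es)) *ℚ val P₂ (toSubset (rights es))
  val-lefts-rights es = cong₂ (λ x y → val P₁ x *ℚ val P₂ y)
    (tabulate-≗lookup _ _ (λ a → sym (Left.member-mapMaybe es a)))
    (tabulate-≗lookup _ _ (λ b → sym (Right.member-mapMaybe es b)))

  realises-∥ : ∀ {C₁ C₂ : Cmd Act} → Realises C₁ P₁ → Realises C₂ P₂ → Realises (C₁ ∥ C₂) P
  realises-∥ real₁ real₂ es chain =
    Run-resp-≡ (sym (val-lefts-rights es))
      (Run-∥ (real₁ _ (lefts-MaximalChain es chain)) (real₂ _ (rights-MaximalChain es chain)) (labels-interleave es))

module Choice {Act : Set} (p : ℚ) (P₁ P₂ : PES Act) where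
  open Sum (size P₁) (size P₂)
  P = choicePES p P₁ P₂

  L₁ : Fin (size P₁) → Fin (size P)
  L₁ a = suc (L a)
  L₂ : Fin (size P₂) → Fin (size P)
  L₂ b = suc (R b)

  data ChoiceView : Fin (size P) → Set where
    isτ : ChoiceView zero
    is₁ : ∀ a → ChoiceView (L₁ a)
    is₂ : ∀ b → ChoiceView (L₂ b)

  choiceView : ∀ i → ChoiceView i
  choiceView zero = isτ
  choiceView (suc i) with view i
  ... | isL a = is₁ a
  ... | isR b = is₂ b

  leq-11 : ∀ a a′ → leq P (L₁ a) (L₁ a′) ≡ leq P₁ a a′
  leq-11 a a′ rewrite splitAt-L a | splitAt-L a′ = refl
  leq-22 : ∀ b b′ → leq P (L₂ b) (L₂ b′) ≡ leq P₂ b b′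
  leq-22 b b′ rewrite splitAt-R b | splitAt-R b′ = refl
  leq-12 : ∀ a b → leq P (L₁ a) (L₂ b) ≡ false
  leq-12 a b rewrite splitAt-L a | splitAt-R b = refl
  leq-21 : ∀ a b → leq P (L₂ b) (L₁ a) ≡ false
  leq-21 a b rewrite splitAt-L a | splitAt-R b = refl
  cf-11 : ∀ a a′ → cf P (L₁ a) (L₁ a′) ≡ cf P₁ a a′
  cf-11 a a′ rewrite splitAt-L a | splitAt-L a′ = refl
  cf-22 : ∀ b b′ → cf P (L₂ b) (L₂ b′) ≡ cf P₂ b b′
  cf-22 b b′ rewrite splitAt-R b | splitAt-R b′ = refl
  cf-12 : ∀ a b → cf P (L₁ a) (L₂ b) ≡ true
  cf-12 a b rewrite splitAt-L a | splitAt-R b = refl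
  lab-1 : ∀ a → lab P (L₁ a) ≡ lab P₁ a
  lab-1 a rewrite splitAt-L a = refl
  lab-2 : ∀ b → lab P (L₂ b) ≡ lab P₂ b
  lab-2 b rewrite splitAt-R b = refl

  proj₁ᶜ : Fin (size P) → Maybe (Fin (size P₁))
  proj₁ᶜ zero = nothing
  proj₁ᶜ (suc i) = projˡ i
  proj₂ᶜ : Fin (size P) → Maybe (Fin (size P₂))
  proj₂ᶜ zero = nothing
  proj₂ᶜ (suc i) = projʳ i

  proj₁ᶜ-just : ∀ {i a} → proj₁ᶜ i ≡ just a → i ≡ L₁ a
  proj₁ᶜ-just {suc i} e = cong suc (projˡ-just e)
  proj₂ᶜ-just : ∀ {i b} → proj₂ᶜ i ≡ just b → i ≡ L₂ b
  proj₂ᶜ-just {suc i} e = cong suc (projʳ-just e)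

  module Branch₁ = Restriction {P = P} {Q = P₁} proj₁ᶜ L₁ proj₁ᶜ-just projˡ-L
  module Branch₂ = Restriction {P = P} {Q = P₂} proj₂ᶜ L₂ proj₂ᶜ-just projʳ-R

  withτ : Pred (size P₁) → Pred (size P₂) → Pred (size P)
  withτ A B zero = true
  withτ A B (suc i) = [ A , B ]ᶠ i

  withτ-Config : ∀ {A B} → Config P₁ A → Config P₂ B → (∀ a b → A a ≡ true → B b ≡ true → ⊥) →
    Config P (withτ A B)
  withτ-Config {A} {B} (d₁ , c₁) (d₂ , c₂) disjoint = down , free
    where
    down : DownClosed P (withτ A B)
    down i j with choiceView i | choiceView j
    ... | isτ | _ = λ _ _ → refl
    ... | is₁ a | isτ = λ _ ()
    ... | is₂ b | isτ = λ _ ()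
    ... | is₁ a | is₁ a′ = λ x l → trans ([,]ᶠ-L A B a) (d₁ a a′ (trans (sym ([,]ᶠ-L A B a′)) x) (trans (sym (leq-11 a a′)) l))
    ... | is₂ b | is₂ b′ = λ x l → trans ([,]ᶠ-R A B b) (d₂ b b′ (trans (sym ([,]ᶠ-R A B b′)) x) (trans (sym (leq-22 b b′)) l))
    ... | is₁ a | is₂ b′ = λ _ l → absurdᵇ l (leq-12 a b′)
    ... | is₂ b | is₁ a′ = λ _ l → absurdᵇ l (leq-21 a′ b)
    free : ConflictFree P (withτ A B)
    free i j with choiceView i | choiceView j
    ... | isτ | _ = λ _ _ → refl
    ... | is₁ a | isτ = λ _ _ → refl
    ... | is₂ b | isτ = λ _ _ → refl
    ... | is₁ a | is₁ a′ = λ x y → trans (cf-11 a a′) (c₁ a a′ (trans (sym ([,]ᶠ-L A B a)) x) (trans (sym ([,]ᶠ-L A B a′)) y))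
    ... | is₂ b | is₂ b′ = λ x y → trans (cf-22 b b′) (c₂ b b′ (trans (sym ([,]ᶠ-R A B b)) x) (trans (sym ([,]ᶠ-R A B b′)) y))
    ... | is₁ a | is₂ b′ = λ x y → ⊥-elim (disjoint a b′ (trans (sym ([,]ᶠ-L A B a)) x) (trans (sym ([,]ᶠ-R A B b′)) y))
    ... | is₂ b | is₁ a′ = λ x y → ⊥-elim (disjoint a′ b (trans (sym ([,]ᶠ-L A B a′)) y) (trans (sym ([,]ᶠ-R A B b)) x))

  -- {τ} is a configuration, so a maximal chain is nonempty; τ lies below every
  -- event, so it comes first.
  MaximalChain-τ∷ : ∀ es → MaximalChain P es → ∃ λ rest → es ≡ zero ∷ rest
  MaximalChain-τ∷ [] (_ , _ , (_ , mx)) =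
    absurdᵇ (mx (withτ _ _) (withτ-Config (∅-Config P₁) (∅-Config P₂) (λ _ _ ()))
                (λ i x → absurdᵇ x (member-[] i)) zero refl)
            (member-[] {size P} zero)
  MaximalChain-τ∷ (e₀ ∷ rest) (_ , prefixes , _)
    with member⇒∈ (e₀ ∷ []) zero (proj₁ (prefixes 1) zero e₀ (∈⇒member (e₀ ∷ []) e₀ (here refl)) refl)
  ... | here refl = rest , refl

  branch₁-MaximalChain : ∀ es → mapMaybe proj₂ᶜ es ≡ [] → MaximalChain P es → MaximalChain P₁ (mapMaybe proj₁ᶜ es)
  branch₁-MaximalChain es no₂ chain =
    Branch₁.restrict-MaximalChain (Config-restrict {P = P} {Q = P₁} L₁ leq-11 cf-11) es extend chain
    where
    extend : ∀ h → Config P₁ h → member (mapMaybe proj₁ᶜ es) ⊆ᵖ h → _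
    extend h ch sub = withτ h (λ _ → false) , withτ-Config ch (∅-Config P₂) (λ _ _ _ ()) , es⊆ , [,]ᶠ-L h _
      where
      es⊆ : member es ⊆ᵖ withτ h (λ _ → false)
      es⊆ i x with choiceView i
      ... | isτ = refl
      ... | is₁ a = trans ([,]ᶠ-L h _ a) (sub a (trans (Branch₁.member-mapMaybe es a) x))
      ... | is₂ b = absurdᵇ (trans (Branch₂.member-mapMaybe es b) x) (trans (cong (λ z → member z b) no₂) (member-[] b))

  branch₂-MaximalChain : ∀ es → mapMaybe proj₁ᶜ es ≡ [] → MaximalChain P es → MaximalChain P₂ (mapMaybe proj₂ᶜ es)
  branch₂-MaximalChain es no₁ chain =
    Branch₂.restrict-MaximalChain (Config-restrict {P = P} {Q = P₂} L₂ leq-22 cf-22) es extend chain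
    where
    extend : ∀ h → Config P₂ h → member (mapMaybe proj₂ᶜ es) ⊆ᵖ h → _
    extend h ch sub = withτ (λ _ → false) h , withτ-Config (∅-Config P₁) ch (λ _ _ ()) , es⊆ , [,]ᶠ-R _ h
      where
      es⊆ : member es ⊆ᵖ withτ (λ _ → false) h
      es⊆ i x with choiceView i
      ... | isτ = refl
      ... | is₂ b = trans ([,]ᶠ-R _ h b) (sub b (trans (Branch₂.member-mapMaybe es b) x))
      ... | is₁ a = absurdᵇ (trans (Branch₁.member-mapMaybe es a) x) (trans (cong (λ z → member z a) no₁) (member-[] a))

  -- Events of different branches are in conflict.
  MaximalChain-branches : ∀ rest → MaximalChain P (zero ∷ rest) →
    (∃ λ es₁ → rest ≡ map L₁ es₁ × MaximalChain P₁ es₁) ⊎ (∃ λ es₂ → rest ≡ map L₂ es₂ × MaximalChain P₂ es₂)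
  MaximalChain-branches rest chain@((τ∉rest ∷ _) , _ , ((_ , c) , _))
    with mapMaybe proj₂ᶜ rest in no₂ | mapMaybe proj₁ᶜ rest in no₁
  ... | [] | _ = inj₁ (_ , Branch₁.map-emb-mapMaybe rest (All.tabulate only₁) , branch₁-MaximalChain (zero ∷ rest) no₂ chain)
    where
    only₁ : ∀ {y} → y ∈ rest → ∃ λ a → y ≡ L₁ a
    only₁ {y} m with choiceView y
    ... | isτ = ⊥-elim (All.lookup τ∉rest m refl)
    ... | is₁ a = a , refl
    ... | is₂ b with subst (b ∈_) no₂ (Branch₂.∈-mapMaybe⁺ rest m)
    ... | ()
  ... | _ ∷ _ | [] = inj₂ (_ , Branch₂.map-emb-mapMaybe rest (All.tabulate only₂) , branch₂-MaximalChain (zero ∷ rest) no₁ chain)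
    where
    only₂ : ∀ {y} → y ∈ rest → ∃ λ b → y ≡ L₂ b
    only₂ {y} m with choiceView y
    ... | isτ = ⊥-elim (All.lookup τ∉rest m refl)
    ... | is₂ b = b , refl
    ... | is₁ a with subst (a ∈_) no₁ (Branch₁.∈-mapMaybe⁺ rest m)
    ... | ()
  ... | b ∷ _ | a ∷ _ = absurdᵇ (cf-12 a b) (c (L₁ a) (L₂ b) (in-chain (Branch₁.∈-mapMaybe⁻ rest a∈)) (in-chain (Branch₂.∈-mapMaybe⁻ rest b∈)))
    where
    in-chain : ∀ {i} → i ∈ rest → member (zero ∷ rest) i ≡ true
    in-chain m = ∈⇒member (zero ∷ rest) _ (there m)
    a∈ : a ∈ mapMaybe proj₁ᶜ rest
    a∈ = subst (a ∈_) (sym no₁) (here refl)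
    b∈ : b ∈ mapMaybe proj₂ᶜ rest
    b∈ = subst (b ∈_) (sym no₂) (here refl)

  module AfterTau (ys : List (Fin (size P))) (c : Config P (member (zero ∷ ys))) where
    x = toSubset (zero ∷ ys)

    x≡true∷tail : x ≡ true ∷ tail x
    x≡true∷tail = ≡true∷tail x (∈⇒member (zero ∷ ys) zero (here refl))

    lookup-tail-x : ∀ i → lookup (tail x) i ≡ member (zero ∷ ys) (suc i)
    lookup-tail-x = lookup-tail x

    isConfig-true∷tail : isConfigB P (true ∷ tail x) ≡ true
    isConfig-true∷tail = subst (λ z → isConfigB P z ≡ true) x≡true∷tail (isConfigB-complete P x c)

  val-τ∷₁ : ∀ r → isConfigB P (true ∷ r) ≡ true → nonEmptyB (restrictʳ {size P₁} r) ≡ false →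
    nonEmptyB (restrictˡ {size P₁} r) ≡ true → val P (true ∷ r) ≡ p *ℚ val P₁ (restrictˡ {size P₁} r)
  val-τ∷₁ r e₁ e₂ e₃ rewrite e₁ | e₂ | e₃ = refl

  val-τ∷₂ : ∀ r → isConfigB P (true ∷ r) ≡ true → nonEmptyB (restrictʳ {size P₁} r) ≡ true →
    val P (true ∷ r) ≡ (1ℚ - p) *ℚ val P₂ (restrictʳ {size P₁} r)
  val-τ∷₂ r e₁ e₂ rewrite e₁ | e₂ = refl

  val-branch₁ : ∀ a es → Config P (member (zero ∷ map L₁ (a ∷ es))) →
    val P (toSubset (zero ∷ map L₁ (a ∷ es))) ≡ p *ℚ val P₁ (toSubset (a ∷ es))
  val-branch₁ a es c = begin
    val P x                                ≡⟨ cong (val P) x≡true∷tail ⟩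
    val P (true ∷ tail x)                  ≡⟨ val-τ∷₁ (tail x) isConfig-true∷tail no₂ some₁ ⟩
    p *ℚ val P₁ (restrictˡ (tail x))        ≡⟨ cong (λ z → p *ℚ val P₁ z) restrict≡ ⟩
    p *ℚ val P₁ (toSubset (a ∷ es))        ∎
    where
    open ≡-Reasoning
    ys = map L₁ (a ∷ es)
    open AfterTau ys c
    L₂∉ : ∀ b → L₂ b ∉ zero ∷ ys
    L₂∉ b (there m) with ∈-map⁻ L₁ m
    ... | _ , _ , eq = L≢R (sym (suc-injective eq))
    no₂ : nonEmptyB (restrictʳ {size P₁} (tail x)) ≡ false
    no₂ = anyB-false⁺ _ (λ b → trans (lookup∘tabulate _ b) (trans (lookup-tail-x (R b)) (∉⇒member (zero ∷ ys) (L₂ b) (L₂∉ b))))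
    some₁ : nonEmptyB (restrictˡ {size P₁} (tail x)) ≡ true
    some₁ = anyB⁺ _ a (trans (lookup∘tabulate _ a) (trans (lookup-tail-x (L a)) (∈⇒member (zero ∷ ys) (L₁ a) (there (here refl)))))
    restrict≡ : restrictˡ {size P₁} (tail x) ≡ toSubset (a ∷ es)
    restrict≡ = tabulate-≗lookup _ _ λ a′ → begin
      lookup (tail x) (L a′)                 ≡⟨ lookup-tail-x (L a′) ⟩
      member (zero ∷ ys) (L₁ a′)             ≡⟨ Branch₁.member-mapMaybe (zero ∷ ys) a′ ⟨
      member (mapMaybe proj₁ᶜ ys) a′         ≡⟨ cong (λ z → member z a′) (Branch₁.mapMaybe-map-emb (a ∷ es)) ⟩
      member (a ∷ es) a′                     ∎

  val-branch₂ : ∀ b es → Config P (member (zero ∷ map L₂ (b ∷ es))) →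
    val P (toSubset (zero ∷ map L₂ (b ∷ es))) ≡ (1ℚ - p) *ℚ val P₂ (toSubset (b ∷ es))
  val-branch₂ b es c = begin
    val P x                                       ≡⟨ cong (val P) x≡true∷tail ⟩
    val P (true ∷ tail x)                         ≡⟨ val-τ∷₂ (tail x) isConfig-true∷tail some₂ ⟩
    (1ℚ - p) *ℚ val P₂ (restrictʳ (tail x))        ≡⟨ cong (λ z → (1ℚ - p) *ℚ val P₂ z) restrict≡ ⟩
    (1ℚ - p) *ℚ val P₂ (toSubset (b ∷ es))        ∎
    where
    open ≡-Reasoning
    ys = map L₂ (b ∷ es)
    open AfterTau ys c
    some₂ : nonEmptyB (restrictʳ {size P₁} (tail x)) ≡ true
    some₂ = anyB⁺ _ b (trans (lookup∘tabulate _ b) (trans (lookup-tail-x (R b)) (∈⇒member (zero ∷ ys) (L₂ b) (there (here refl)))))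
    restrict≡ : restrictʳ {size P₁} (tail x) ≡ toSubset (b ∷ es)
    restrict≡ = tabulate-≗lookup _ _ λ b′ → begin
      lookup (tail x) (R b′)                 ≡⟨ lookup-tail-x (R b′) ⟩
      member (zero ∷ ys) (L₂ b′)             ≡⟨ Branch₂.member-mapMaybe (zero ∷ ys) b′ ⟨
      member (mapMaybe proj₂ᶜ ys) b′         ≡⟨ cong (λ z → member z b′) (Branch₂.mapMaybe-map-emb (b ∷ es)) ⟩
      member (b ∷ es) b′                     ∎

  Run-branch₁ : ∀ {C₁ C₂ : Cmd Act} .{h₁ h₂} es → Config P (member (zero ∷ map L₁ es)) →
    Run C₁ (val P₁ (toSubset es)) (map (lab P₁) es) →
    Run (choice C₁ p h₁ h₂ C₂) (val P (toSubset (zero ∷ map L₁ es))) (map (lab P) (zero ∷ map L₁ es))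
  Run-branch₁ [] _ r = Run-nonempty r
  Run-branch₁ (a ∷ es) c r =
    subst₂ (Run _) (sym (val-branch₁ a es c)) (cong (τ ∷_) (sym (map-lab-emb {P = P} {Q = P₁} L₁ lab-1 (a ∷ es))))
      (branch _ choice-step (here refl) r)

  Run-branch₂ : ∀ {C₁ C₂ : Cmd Act} .{h₁ h₂} es → Config P (member (zero ∷ map L₂ es)) →
    Run C₂ (val P₂ (toSubset es)) (map (lab P₂) es) →
    Run (choice C₁ p h₁ h₂ C₂) (val P (toSubset (zero ∷ map L₂ es))) (map (lab P) (zero ∷ map L₂ es))
  Run-branch₂ [] _ r = Run-nonempty r
  Run-branch₂ (b ∷ es) c r =
    subst₂ (Run _) (sym (val-branch₂ b es c)) (cong (τ ∷_) (sym (map-lab-emb {P = P} {Q = P₂} L₂ lab-2 (b ∷ es))))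
      (branch _ choice-step (there (here refl)) r)

  realises-choice : ∀ {C₁ C₂ : Cmd Act} .{h₁ h₂} → Realises C₁ P₁ → Realises C₂ P₂ → Realises (choice C₁ p h₁ h₂ C₂) P
  realises-choice real₁ real₂ es chain with MaximalChain-τ∷ es chain
  ... | rest , refl with MaximalChain-branches rest chain
  ... | inj₁ (es₁ , refl , chain₁) = Run-branch₁ es₁ (proj₁ (proj₂ (proj₂ chain))) (real₁ es₁ chain₁)
  ... | inj₂ (es₂ , refl , chain₂) = Run-branch₂ es₂ (proj₁ (proj₂ (proj₂ chain))) (real₂ es₂ chain₂)

sameIdx : ∀ {k} → Fin k → Fin k → Bool
sameIdx j j′ = ⌊ j ≟ j′ ⌋

sameIdx-refl : ∀ {k} (j : Fin k) → sameIdx j j ≡ true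
sameIdx-refl j with j ≟ j
... | yes _ = refl
... | no j≢j = ⊥-elim (j≢j refl)

sameIdx-true : ∀ {k} (j j′ : Fin k) → sameIdx j j′ ≡ true → j ≡ j′
sameIdx-true j j′ e with j ≟ j′
... | yes j≡j′ = j≡j′

sameIdx-false : ∀ {k} (j j′ : Fin k) → ¬ j ≡ j′ → sameIdx j j′ ≡ false
sameIdx-false j j′ j≢j′ with j ≟ j′
... | yes j≡j′ = ⊥-elim (j≢j′ j≡j′)
... | no _ = refl

-- The sequential case is proved against these facts about seqPES rather than
-- against its definition: the events are those of P₁ (via L) and, for each
-- maximal configuration mc j of P₁, a copy of those of P₂ (via R j).
record SeqEncoding {Act : Set} (P₁ P₂ P : PES Act) : Set₁ where
  field
    k : ℕ
    mc : Fin k → Subset (size P₁)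
    mc-maximal : ∀ j → Maximal P₁ (lookup (mc j))
    mc-complete : ∀ x → Maximal P₁ (lookup x) → ∃ λ j → mc j ≡ x
    L : Fin (size P₁) → Fin (size P)
    R : Fin k → Fin (size P₂) → Fin (size P)
    L-or-R : ∀ i → (∃ λ a → i ≡ L a) ⊎ (∃₂ λ j e → i ≡ R j e)
    L≢R : ∀ {a j e} → L a ≡ R j e → ⊥
    R-injective : ∀ {j e j′ e′} → R j e ≡ R j′ e′ → j ≡ j′ × e ≡ e′
    [_,_]ˢ : ∀ {A : Set} → (Fin (size P₁) → A) → (Fin k → Fin (size P₂) → A) → Fin (size P) → A
    [,]ˢ-L : ∀ {A : Set} (f : Fin (size P₁) → A) g a → [ f , g ]ˢ (L a) ≡ f a
    [,]ˢ-R : ∀ {A : Set} (f : Fin (size P₁) → A) g j e → [ f , g ]ˢ (R j e) ≡ g j e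
    leq-LL : ∀ a a′ → leq P (L a) (L a′) ≡ leq P₁ a a′
    leq-LR : ∀ a j e → leq P (L a) (R j e) ≡ lookup (mc j) a
    leq-RL : ∀ a j e → leq P (R j e) (L a) ≡ false
    leq-RR : ∀ j e j′ e′ → leq P (R j e) (R j′ e′) ≡ sameIdx j j′ ∧ leq P₂ e e′
    cf-LL : ∀ a a′ → cf P (L a) (L a′) ≡ cf P₁ a a′
    cf-LR : ∀ a j e → cf P (L a) (R j e) ≡ anyB (λ a′ → lookup (mc j) a′ ∧ cf P₁ a a′)
    cf-RL : ∀ a j e → cf P (R j e) (L a) ≡ anyB (λ a′ → lookup (mc j) a′ ∧ cf P₁ a a′)
    cf-RR : ∀ j e j′ e′ → cf P (R j e) (R j′ e′) ≡ (if sameIdx j j′ then cf P₂ e e′ else true)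
    lab-L : ∀ a → lab P (L a) ≡ lab P₁ a
    lab-R : ∀ j e → lab P (R j e) ≡ lab P₂ e
    val-R : ∀ x j → isConfigB P x ≡ true →
      firstJust (λ j → if nonEmptyB (tabulate (λ e → lookup x (R j e))) then just j else nothing) ≡ just j →
      val P x ≡ val P₁ (tabulate (λ a → lookup x (L a))) *ℚ val P₂ (tabulate (λ e → lookup x (R j e)))

seqEncoding : (P₁ P₂ : PES Act) → SeqEncoding P₁ P₂ (seqPES P₁ P₂)
seqEncoding {Act} P₁ P₂ = record
  { k = k ; mc = mc ; mc-maximal = mc-maximal ; mc-complete = mc-complete
  ; L = L ; R = R′ ; L-or-R = L-or-R ; L≢R = λ e → L≢R e ; R-injective = R′-injective
  ; [_,_]ˢ = [_,_]ˢ ; [,]ˢ-L = [,]ˢ-L ; [,]ˢ-R = [,]ˢ-R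
  ; leq-LL = leq-LL ; leq-LR = leq-LR ; leq-RL = leq-RL ; leq-RR = leq-RR
  ; cf-LL = cf-LL ; cf-LR = cf-LR ; cf-RL = cf-RL ; cf-RR = cf-RR
  ; lab-L = lab-L ; lab-R = lab-R ; val-R = val-R }
  where
  n₁ = size P₁
  n₂ = size P₂
  k = List.length (maxConfigs P₁)
  mc : Fin k → Subset n₁
  mc j = List.lookup (maxConfigs P₁) j
  open Sum n₁ (k * n₂)
  P = seqPES P₁ P₂

  R′ : Fin k → Fin n₂ → Fin (size P)
  R′ j e = R (combine j e)

  rq : ∀ j e → remQuot {k} n₂ (combine j e) ≡ (j , e)
  rq = remQuot-combine
  rq₁ : ∀ j e → proj₂ (quotRem {k} n₂ (combine j e)) ≡ j
  rq₁ j e = cong proj₁ (rq j e)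
  rq₂ : ∀ j e → proj₁ (quotRem {k} n₂ (combine j e)) ≡ e
  rq₂ j e = cong proj₂ (rq j e)

  mc-maximal : ∀ j → Maximal P₁ (lookup (mc j))
  mc-maximal j = IsMaximal→Maximal P₁ (mc j)
    (proj₂ (∈-filter⁻ (λ x → T? (isMaximalB P₁ x)) {xs = allSubsets n₁} (∈-lookup {xs = maxConfigs P₁} j)))

  mc-complete : ∀ x → Maximal P₁ (lookup x) → ∃ λ j → mc j ≡ x
  mc-complete x m = index x∈ , sym (lookup-index x∈)
    where
    x∈ : x ∈ maxConfigs P₁
    x∈ = ∈-filter⁺ (λ x → T? (isMaximalB P₁ x)) (allSubsets-complete n₁ x)
           (subst T (sym (Maximal→isMaximalB P₁ x m)) _)

  L-or-R : ∀ i → (∃ λ a → i ≡ L a) ⊎ (∃₂ λ j e → i ≡ R′ j e)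
  L-or-R i with view i
  ... | isL a = inj₁ (a , refl)
  ... | isR r = inj₂ (_ , _ , cong R (sym (combine-remQuot {k} n₂ r)))

  R′-injective : ∀ {j e j′ e′} → R′ j e ≡ R′ j′ e′ → j ≡ j′ × e ≡ e′
  R′-injective {j} {e} {j′} {e′} q with trans (sym (rq j e)) (trans (cong (remQuot {k} n₂) (R-injective q)) (rq j′ e′))
  ... | refl = refl , refl

  [_,_]ˢ : ∀ {A : Set} → (Fin n₁ → A) → (Fin k → Fin n₂ → A) → Fin (size P) → A
  [ f , g ]ˢ = [ f , (λ r → uncurry g (remQuot {k} n₂ r)) ]ᶠ
  [,]ˢ-L : ∀ {A : Set} (f : Fin n₁ → A) g a → [ f , g ]ˢ (L a) ≡ f a
  [,]ˢ-L f g a = [,]ᶠ-L f _ a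
  [,]ˢ-R : ∀ {A : Set} (f : Fin n₁ → A) g j e → [ f , g ]ˢ (R′ j e) ≡ g j e
  [,]ˢ-R f g j e = trans ([,]ᶠ-R f _ (combine j e)) (cong (uncurry g) (rq j e))

  leq-LL : ∀ a a′ → leq P (L a) (L a′) ≡ leq P₁ a a′
  leq-LL a a′ rewrite splitAt-L a | splitAt-L a′ = refl
  leq-LR : ∀ a j e → leq P (L a) (R′ j e) ≡ lookup (mc j) a
  leq-LR a j e rewrite splitAt-L a | splitAt-R (combine j e) | rq₁ j e = refl
  leq-RL : ∀ a j e → leq P (R′ j e) (L a) ≡ false
  leq-RL a j e rewrite splitAt-L a | splitAt-R (combine j e) = refl
  leq-RR : ∀ j e j′ e′ → leq P (R′ j e) (R′ j′ e′) ≡ sameIdx j j′ ∧ leq P₂ e e′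
  leq-RR j e j′ e′ rewrite splitAt-R (combine j e) | rq₁ j e | rq₂ j e | splitAt-R (combine j′ e′) | rq₁ j′ e′ | rq₂ j′ e′ = refl
  cf-LL : ∀ a a′ → cf P (L a) (L a′) ≡ cf P₁ a a′
  cf-LL a a′ rewrite splitAt-L a | splitAt-L a′ = refl
  cf-LR : ∀ a j e → cf P (L a) (R′ j e) ≡ anyB (λ a′ → lookup (mc j) a′ ∧ cf P₁ a a′)
  cf-LR a j e rewrite splitAt-L a | splitAt-R (combine j e) | rq₁ j e = refl
  cf-RL : ∀ a j e → cf P (R′ j e) (L a) ≡ anyB (λ a′ → lookup (mc j) a′ ∧ cf P₁ a a′)
  cf-RL a j e rewrite splitAt-L a | splitAt-R (combine j e) | rq₁ j e = refl
  cf-RR : ∀ j e j′ e′ → cf P (R′ j e) (R′ j′ e′) ≡ (if sameIdx j j′ then cf P₂ e e′ else true)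
  cf-RR j e j′ e′ rewrite splitAt-R (combine j e) | rq₁ j e | rq₂ j e | splitAt-R (combine j′ e′) | rq₁ j′ e′ | rq₂ j′ e′ = refl
  lab-L : ∀ a → lab P (L a) ≡ lab P₁ a
  lab-L a rewrite splitAt-L a = refl
  lab-R : ∀ j e → lab P (R′ j e) ≡ lab P₂ e
  lab-R j e rewrite splitAt-R (combine j e) | rq₂ j e = refl

  val-R : ∀ x j → isConfigB P x ≡ true →
    firstJust (λ j → if nonEmptyB (tabulate (λ e → lookup x (R′ j e))) then just j else nothing) ≡ just j →
    val P x ≡ val P₁ (tabulate (λ a → lookup x (L a))) *ℚ val P₂ (tabulate (λ e → lookup x (R′ j e)))
  val-R x j e₁ e₂ rewrite e₁ | e₂ = refl

firstJust-unique : ∀ {k} {A : Set} (g : Fin k → Maybe A) j a → g j ≡ just a →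
  (∀ j′ → ¬ j′ ≡ j → g j′ ≡ nothing) → firstJust g ≡ just a
firstJust-unique g zero a e others rewrite e = refl
firstJust-unique g (suc j) a e others rewrite others zero (λ ()) =
  firstJust-unique (g ∘ suc) j a e (λ j′ j′≢j → others (suc j′) (λ q → j′≢j (suc-injective q)))

take-length-++ : ∀ {A : Set} (as : List A) x bs → take (suc (length as)) (as ++ x ∷ bs) ≡ as ++ x ∷ []
take-length-++ [] x bs = refl
take-length-++ (a ∷ as) x bs = cong (a ∷_) (take-length-++ as x bs)

Unique-++-∷ : ∀ {A : Set} (as : List A) {y bs x} → Unique (as ++ y ∷ bs) → x ∈ as → x ∉ bs
Unique-++-∷ (a ∷ as) (a∉ ∷ u) (here refl) x∈bs = All.lookup a∉ (∈-++⁺ʳ as (there x∈bs)) refl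
Unique-++-∷ (a ∷ as) (_ ∷ u) (there x∈as) x∈bs = Unique-++-∷ as u x∈as x∈bs

module Sequential {Act : Set} {P₁ P₂ P : PES Act} (enc : SeqEncoding P₁ P₂ P) where
  open SeqEncoding enc

  data SeqView : Fin (size P) → Set where
    isL : ∀ a → SeqView (L a)
    isR : ∀ j e → SeqView (R j e)

  seqView : ∀ i → SeqView i
  seqView i with L-or-R i
  ... | inj₁ (a , refl) = isL a
  ... | inj₂ (j , e , refl) = isR j e

  leq-RR-same : ∀ j e e′ → leq P (R j e) (R j e′) ≡ leq P₂ e e′
  leq-RR-same j e e′ = trans (leq-RR j e j e′) (cong (_∧ leq P₂ e e′) (sameIdx-refl j))
  cf-RR-same : ∀ j e e′ → cf P (R j e) (R j e′) ≡ cf P₂ e e′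
  cf-RR-same j e e′ = trans (cf-RR j e j e′) (cong (λ z → if z then cf P₂ e e′ else true) (sameIdx-refl j))

  -- A configuration of P is a configuration A of P₁ together with at most one
  -- copy j in use, whose part B j lies above mc j ⊆ A.
  [,]ˢ-Config : ∀ {A B} → Config P₁ A → (∀ j → Config P₂ (B j)) →
    (∀ j e a → B j e ≡ true → lookup (mc j) a ≡ true → A a ≡ true) →
    (∀ j e j′ e′ → B j e ≡ true → B j′ e′ ≡ true → j ≡ j′) → Config P [ A , B ]ˢ
  [,]ˢ-Config {A} {B} (d₁ , c₁) configB above-mc one-copy = down , free
    where
    down : DownClosed P [ A , B ]ˢ
    down i i′ with seqView i | seqView i′
    ... | isL a | isL a′ = λ x l → trans ([,]ˢ-L A B a) (d₁ a a′ (trans (sym ([,]ˢ-L A B a′)) x) (trans (sym (leq-LL a a′)) l))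
    ... | isL a | isR j e = λ x l → trans ([,]ˢ-L A B a) (above-mc j e a (trans (sym ([,]ˢ-R A B j e)) x) (trans (sym (leq-LR a j e)) l))
    ... | isR j e | isL a = λ _ l → absurdᵇ l (leq-RL a j e)
    ... | isR j e | isR j′ e′ = λ x l → same-copy (trans (sym (leq-RR j e j′ e′)) l) (trans (sym ([,]ˢ-R A B j′ e′)) x)
      where
      same-copy : sameIdx j j′ ∧ leq P₂ e e′ ≡ true → B j′ e′ ≡ true → [ A , B ]ˢ (R j e) ≡ true
      same-copy s b with sameIdx-true j j′ (∧-conicalˡ _ _ s)
      ... | refl = trans ([,]ˢ-R A B j e) (proj₁ (configB j) e e′ b (∧-conicalʳ (sameIdx j j) _ s))
    no-cf-below : ∀ a j e → A a ≡ true → B j e ≡ true → anyB (λ a′ → lookup (mc j) a′ ∧ cf P₁ a a′) ≡ false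
    no-cf-below a j e xa be = anyB-false⁺ _ λ a′ → no-cf-at a′
      where
      no-cf-at : ∀ a′ → lookup (mc j) a′ ∧ cf P₁ a a′ ≡ false
      no-cf-at a′ with lookup (mc j) a′ in m
      ... | false = refl
      ... | true = c₁ a a′ xa (above-mc j e a′ be m)
    free : ConflictFree P [ A , B ]ˢ
    free i i′ with seqView i | seqView i′
    ... | isL a | isL a′ = λ x y → trans (cf-LL a a′) (c₁ a a′ (trans (sym ([,]ˢ-L A B a)) x) (trans (sym ([,]ˢ-L A B a′)) y))
    ... | isL a | isR j e = λ x y → trans (cf-LR a j e) (no-cf-below a j e (trans (sym ([,]ˢ-L A B a)) x) (trans (sym ([,]ˢ-R A B j e)) y))
    ... | isR j e | isL a = λ x y → trans (cf-RL a j e) (no-cf-below a j e (trans (sym ([,]ˢ-L A B a)) y) (trans (sym ([,]ˢ-R A B j e)) x))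
    ... | isR j e | isR j′ e′ = λ x y → same-copy (trans (sym ([,]ˢ-R A B j e)) x) (trans (sym ([,]ˢ-R A B j′ e′)) y)
      where
      same-copy : B j e ≡ true → B j′ e′ ≡ true → cf P (R j e) (R j′ e′) ≡ false
      same-copy b b′ with one-copy j e j′ e′ b b′
      ... | refl = trans (cf-RR-same j e e′) (proj₂ (configB j) e e′ b b′)

  only-at : Fin k → Pred (size P₂) → Fin k → Pred (size P₂)
  only-at j h j′ e = sameIdx j′ j ∧ h e

  only-at-Config : ∀ j h → Config P₂ h → ∀ j′ → Config P₂ (only-at j h j′)
  only-at-Config j h ch j′ with sameIdx j′ j
  ... | true = ch
  ... | false = ∅-Config P₂

  only-at-index : ∀ {j h j′ e} → only-at j h j′ e ≡ true → j′ ≡ j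
  only-at-index {j} {j′ = j′} o = sameIdx-true j′ j (∧-conicalˡ _ _ o)

  only-at-one-copy : ∀ j h j′ e j″ e′ → only-at j h j′ e ≡ true → only-at j h j″ e′ ≡ true → j′ ≡ j″
  only-at-one-copy j h j′ e j″ e′ o o′ = trans (only-at-index {j} {h} o) (sym (only-at-index {j} {h} o′))

  projˡ : Fin (size P) → Maybe (Fin (size P₁))
  projˡ = [ just , (λ _ _ → nothing) ]ˢ

  projˡ-just : ∀ {i a} → projˡ i ≡ just a → i ≡ L a
  projˡ-just {i} q with seqView i
  ... | isL a′ with trans (sym ([,]ˢ-L just _ a′)) q
  ... | refl = refl
  projˡ-just {i} q | isR j e with trans (sym ([,]ˢ-R just _ j e)) q
  ... | ()

  projʳ : Fin k → Fin (size P) → Maybe (Fin (size P₂))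
  projʳ j = [ (λ _ → nothing) , (λ j′ e → if sameIdx j′ j then just e else nothing) ]ˢ

  projʳ-R : ∀ j e → projʳ j (R j e) ≡ just e
  projʳ-R j e = trans ([,]ˢ-R _ _ j e) (cong (λ z → if z then just e else nothing) (sameIdx-refl j))

  projʳ-just : ∀ j {i e} → projʳ j i ≡ just e → i ≡ R j e
  projʳ-just j {i} q with seqView i
  ... | isL a with trans (sym ([,]ˢ-L _ (λ j′ e → if sameIdx j′ j then just e else nothing) a)) q
  ... | ()
  projʳ-just j {i} q | isR j′ e′ with sameIdx j′ j in s | trans (sym ([,]ˢ-R _ (λ j′ e → if sameIdx j′ j then just e else nothing) j′ e′)) q
  ... | true | refl with sameIdx-true j′ j s
  ... | refl = refl
  projʳ-just j {i} q | isR j′ e′ | false | ()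

  module Left = Restriction {P = P} {Q = P₁} projˡ L projˡ-just ([,]ˢ-L just _)
  module Right (j : Fin k) = Restriction {P = P} {Q = P₂} (projʳ j) (R j) (projʳ-just j) (projʳ-R j)

  restrict-L : ∀ X → Config P X → Config P₁ (λ a → X (L a))
  restrict-L = Config-restrict {P = P} {Q = P₁} L leq-LL cf-LL

  restrict-R : ∀ j X → Config P X → Config P₂ (λ e → X (R j e))
  restrict-R j = Config-restrict {P = P} {Q = P₂} (R j) (leq-RR-same j) (cf-RR-same j)

  IsL : Fin (size P) → Set
  IsL y = ∃ λ a → y ≡ L a

  split-at-first-R : ∀ es → All IsL es ⊎ (∃ λ as → ∃₂ λ j e → ∃ λ bs → es ≡ as ++ R j e ∷ bs × All IsL as)
  split-at-first-R [] = inj₁ []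
  split-at-first-R (y ∷ ys) with seqView y
  ... | isR j e = inj₂ ([] , j , e , ys , refl , [])
  ... | isL a with split-at-first-R ys
  ...   | inj₁ all-L = inj₁ ((a , refl) ∷ all-L)
  ...   | inj₂ (as , j , e , bs , eq , as-L) = inj₂ (L a ∷ as , j , e , bs , cong (L a ∷_) eq , (a , refl) ∷ as-L)

  R∉map-L : ∀ j e es₁ → R j e ∉ map L es₁
  R∉map-L j e es₁ m with ∈-map⁻ L m
  ... | _ , _ , q = L≢R (sym q)

  map-L-MaximalChain : ∀ es₁ → MaximalChain P (map L es₁) → MaximalChain P₁ es₁
  map-L-MaximalChain es₁ chain =
    subst (MaximalChain P₁) (Left.mapMaybe-map-emb es₁) (Left.restrict-MaximalChain restrict-L (map L es₁) extend chain)
    where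
    extend : ∀ h → Config P₁ h → member (mapMaybe projˡ (map L es₁)) ⊆ᵖ h → _
    extend h ch sub = [ h , (λ _ _ → false) ]ˢ ,
      [,]ˢ-Config ch (λ _ → ∅-Config P₂) (λ _ _ _ ()) (λ _ _ _ _ ()) , es⊆ , [,]ˢ-L h _
      where
      es⊆ : member (map L es₁) ⊆ᵖ [ h , (λ _ _ → false) ]ˢ
      es⊆ i x with seqView i
      ... | isL a = trans ([,]ˢ-L h _ a) (sub a (trans (Left.member-mapMaybe (map L es₁) a) x))
      ... | isR j e = ⊥-elim (R∉map-L j e es₁ (member⇒∈ (map L es₁) _ x))

  -- The empty chain is maximal in P₂ when the chain stays inside P₁, but no run of C₂ realises it.
  chain-leaves-P₁ : ∀ {C₂ : Cmd Act} → Realises C₂ P₂ → ∀ es₁ → MaximalChain P (map L es₁) → ⊥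
  chain-leaves-P₁ real₂ es₁ chain@(_ , _ , (_ , mx)) = Run-nonempty (real₂ [] ([] , prefixes , (∅-config , maximal-∅)))
    where
    es = map L es₁
    chain₁ = map-L-MaximalChain es₁ chain
    ∅-config : Config P₂ (member [])
    ∅-config = Config-resp-≗ P₂ (λ e → sym (member-[] e)) (∅-Config P₂)
    prefixes : ∀ i → Config P₂ (member (take i []))
    prefixes zero = ∅-config
    prefixes (suc _) = ∅-config
    maximal-∅ : ∀ h → Config P₂ h → member [] ⊆ᵖ h → h ⊆ᵖ member []
    maximal-∅ h ch _ e he with mc-complete (toSubset es₁) (proj₂ (proj₂ chain₁))
    ... | j , mc-j = ⊥-elim (R∉map-L j e es₁ (member⇒∈ es _
                      (mx _ config es⊆ (R j e) (trans ([,]ˢ-R _ B j e) (∧-intro (sameIdx-refl j) he)))))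
      where
      B = only-at j h
      config : Config P [ member es₁ , B ]ˢ
      config = [,]ˢ-Config (proj₁ (proj₂ (proj₂ chain₁))) (only-at-Config j h ch)
        (λ j′ e a b m → mc-j⊆ (only-at-index {j} {h} b) m) (only-at-one-copy j h)
        where
        mc-j⊆ : ∀ {j′ a} → j′ ≡ j → lookup (mc j′) a ≡ true → member es₁ a ≡ true
        mc-j⊆ {a = a} refl = subst (λ z → lookup z a ≡ true) mc-j
      es⊆ : member es ⊆ᵖ [ member es₁ , B ]ˢ
      es⊆ i x with seqView i
      ... | isL a = trans ([,]ˢ-L _ B a) (trans (trans (cong (λ z → member z a) (sym (Left.mapMaybe-map-emb es₁)))
                                                         (Left.member-mapMaybe es a)) x)
      ... | isR j′ e′ = ⊥-elim (R∉map-L j′ e′ es₁ (member⇒∈ es _ x))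

  module Split (j : Fin k) (es₁ : List (Fin (size P₁))) (e₀ : Fin (size P₂)) (bs : List (Fin (size P₂))) where
    es₂ = e₀ ∷ bs
    es = map L es₁ ++ map (R j) es₂

    lefts≡ : mapMaybe projˡ es ≡ es₁
    lefts≡ = begin
      mapMaybe projˡ (map L es₁ ++ map (R j) es₂)                   ≡⟨ mapMaybe-++ projˡ (map L es₁) (map (R j) es₂) ⟩
      mapMaybe projˡ (map L es₁) ++ mapMaybe projˡ (map (R j) es₂)  ≡⟨ cong₂ _++_ (Left.mapMaybe-map-emb es₁) (no-left es₂) ⟩
      es₁ ++ []                                                     ≡⟨ ++-identityʳ es₁ ⟩
      es₁                                                           ∎
      where
      open ≡-Reasoning
      no-left : ∀ ys → mapMaybe projˡ (map (R j) ys) ≡ []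
      no-left [] = refl
      no-left (y ∷ ys) rewrite [,]ˢ-R just (λ _ _ → nothing) j y = no-left ys

    rights≡ : mapMaybe (projʳ j) es ≡ es₂
    rights≡ = trans (mapMaybe-++ (projʳ j) (map L es₁) (map (R j) es₂))
                    (cong₂ _++_ (no-right es₁) (Right.mapMaybe-map-emb j es₂))
      where
      no-right : ∀ xs → mapMaybe (projʳ j) (map L xs) ≡ []
      no-right [] = refl
      no-right (x ∷ xs) rewrite [,]ˢ-L (λ _ → nothing) (λ j′ e → if sameIdx j′ j then just e else nothing) x = no-right xs

    R-index : ∀ j′ e → member es (R j′ e) ≡ true → j′ ≡ j
    R-index j′ e x with ∈-++⁻ (map L es₁) (member⇒∈ es _ x)
    ... | inj₁ m = ⊥-elim (R∉map-L j′ e es₁ m)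
    ... | inj₂ m with ∈-map⁻ (R j) m
    ...   | _ , _ , q = proj₁ (R-injective q)

    R-e₀∈ : member es (R j e₀) ≡ true
    R-e₀∈ = ∈⇒member es _ (∈-++⁺ʳ (map L es₁) (here refl))

    member-es₁ : ∀ a → member es₁ a ≡ member es (L a)
    member-es₁ a = trans (cong (λ z → member z a) (sym lefts≡)) (Left.member-mapMaybe es a)

    member-es₂ : ∀ e → member es₂ e ≡ member es (R j e)
    member-es₂ e = trans (cong (λ z → member z e) (sym rights≡)) (Right.member-mapMaybe j es e)

    mc⊆ : DownClosed P (member es) → ∀ a → lookup (mc j) a ≡ true → member es (L a) ≡ true
    mc⊆ d a m = d (L a) (R j e₀) R-e₀∈ (trans (leq-LR a j e₀) m)

    left-MaximalChain : MaximalChain P es → MaximalChain P₁ es₁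
    left-MaximalChain chain@(_ , _ , ((d , c) , _)) =
      subst (MaximalChain P₁) lefts≡ (Left.restrict-MaximalChain restrict-L es extend chain)
      where
      extend : ∀ h → Config P₁ h → member (mapMaybe projˡ es) ⊆ᵖ h → _
      extend h ch sub = [ h , B ]ˢ , [,]ˢ-Config ch (λ j′ → restrict-R j′ (member es) (d , c)) above one-copy , es⊆ , [,]ˢ-L h B
        where
        B = λ j′ e → member es (R j′ e)
        above : ∀ j′ e a → B j′ e ≡ true → lookup (mc j′) a ≡ true → h a ≡ true
        above j′ e a b m with R-index j′ e b
        ... | refl = sub a (trans (Left.member-mapMaybe es a) (mc⊆ d a m))
        one-copy : ∀ j′ e j″ e′ → B j′ e ≡ true → B j″ e′ ≡ true → j′ ≡ j″
        one-copy j′ e j″ e′ b b′ = trans (R-index j′ e b) (sym (R-index j″ e′ b′))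
        es⊆ : member es ⊆ᵖ [ h , B ]ˢ
        es⊆ i x with seqView i
        ... | isL a = trans ([,]ˢ-L h B a) (sub a (trans (Left.member-mapMaybe es a) x))
        ... | isR j′ e = trans ([,]ˢ-R h B j′ e) x

    right-MaximalChain : MaximalChain P es → MaximalChain P₂ es₂
    right-MaximalChain chain@(_ , _ , ((d , c) , _)) =
      subst (MaximalChain P₂) rights≡ (Right.restrict-MaximalChain j (restrict-R j) es extend chain)
      where
      extend : ∀ h → Config P₂ h → member (mapMaybe (projʳ j) es) ⊆ᵖ h → _
      extend h ch sub = [ A , B ]ˢ , [,]ˢ-Config (restrict-L (member es) (d , c)) (only-at-Config j h ch) above (only-at-one-copy j h) ,
                        es⊆ , (λ e → trans ([,]ˢ-R A B j e) (cong (_∧ h e) (sameIdx-refl j)))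
        where
        A = λ a → member es (L a)
        B = only-at j h
        above : ∀ j′ e a → B j′ e ≡ true → lookup (mc j′) a ≡ true → A a ≡ true
        above j′ e a b m with only-at-index {j} {h} b
        ... | refl = mc⊆ d a m
        es⊆ : member es ⊆ᵖ [ A , B ]ˢ
        es⊆ i x with seqView i
        ... | isL a = trans ([,]ˢ-L A B a) x
        ... | isR j′ e with R-index j′ e x
        ...   | refl = trans ([,]ˢ-R A B j e) (∧-intro (sameIdx-refl j) (sub e (trans (Right.member-mapMaybe j es e) x)))

    -- j is the only copy that the chain meets, so it is the one val-R selects.
    val-split : Config P (member es) → val P (toSubset es) ≡ val P₁ (toSubset es₁) *ℚ val P₂ (toSubset es₂)
    val-split c = trans (val-R x j (isConfigB-complete P x c) (firstJust-unique copy-used j j used-j others-unused))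
      (cong₂ (λ y z → val P₁ y *ℚ val P₂ z) (tabulate-≗lookup _ _ (sym ∘ member-es₁)) (tabulate-≗lookup _ _ (sym ∘ member-es₂)))
      where
      x = toSubset es
      copy-used : Fin k → Maybe (Fin k)
      copy-used j′ = if nonEmptyB (tabulate (λ e → lookup x (R j′ e))) then just j′ else nothing
      used-j : copy-used j ≡ just j
      used-j = cong (λ z → if z then just j else nothing) (anyB⁺ _ e₀ (trans (lookup∘tabulate _ e₀) R-e₀∈))
      others-unused : ∀ j′ → ¬ j′ ≡ j → copy-used j′ ≡ nothing
      others-unused j′ j′≢j = cong (λ z → if z then just j′ else nothing)
        (anyB-false⁺ _ λ e → trans (lookup∘tabulate _ e) (unused e))
        where
        unused : ∀ e → member es (R j′ e) ≡ false
        unused e with member es (R j′ e) in x∋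
        ... | true = ⊥-elim (j′≢j (R-index j′ e x∋))
        ... | false = refl

    labels-split : map (lab P) es ≡ map (lab P₁) es₁ ++ map (lab P₂) es₂
    labels-split = trans (map-++ (lab P) (map L es₁) (map (R j) es₂))
      (cong₂ _++_ (map-lab-emb {P = P} {Q = P₁} L lab-L es₁) (map-lab-emb {P = P} {Q = P₂} (R j) (lab-R j) es₂))

    Run-split : ∀ {C₁ C₂ : Cmd Act} → Realises C₁ P₁ → Realises C₂ P₂ → MaximalChain P es →
      Run (C₁ ⨾ C₂) (val P (toSubset es)) (map (lab P) es)
    Run-split real₁ real₂ chain = subst₂ (Run _) (sym (val-split (proj₁ (proj₂ (proj₂ chain))))) (sym labels-split)
      (Run-⨾ (real₁ es₁ (left-MaximalChain chain)) (real₂ es₂ (right-MaximalChain chain)))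

  module AfterFirstR (as : List (Fin (size P))) (j : Fin k) (e₀ : Fin (size P₂)) (bs : List (Fin (size P))) where
    es = as ++ R j e₀ ∷ bs

    R-e₀∈ : member es (R j e₀) ≡ true
    R-e₀∈ = ∈⇒member es _ (∈-++⁺ʳ as (here refl))

    bs⊆es : ∀ {y} → y ∈ bs → member es y ≡ true
    bs⊆es y∈bs = ∈⇒member es _ (∈-++⁺ʳ as (there y∈bs))

    -- Another copy conflicts with R j e₀.  An event L a of P₁ after R j e₀ would
    -- lie in mc j (by maximality of mc j), hence below R j e₀ and so before it.
    after-first-R : MaximalChain P es → ∀ {y} → y ∈ bs → ∃ λ e → y ≡ R j e
    after-first-R (u , prefixes , ((d , c) , _)) {y} y∈bs with seqView y
    ... | isR j′ e with j′ ≟ j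
    ...   | yes refl = e , refl
    ...   | no j′≢j = absurdᵇ (trans (cf-RR j′ e j e₀) (cong (λ z → if z then cf P₂ e e₀ else true) (sameIdx-false j′ j j′≢j)))
                              (c (R j′ e) (R j e₀) (bs⊆es y∈bs) R-e₀∈)
    after-first-R (u , prefixes , ((d , c) , _)) {y} y∈bs | isL a = ⊥-elim (Unique-++-∷ as u L-a∈as y∈bs)
      where
      a∈mc : lookup (mc j) a ≡ true
      a∈mc = proj₂ (mc-maximal j) (λ a′ → member es (L a′)) (restrict-L (member es) (d , c))
               (λ a′ m → d (L a′) (R j e₀) R-e₀∈ (trans (leq-LR a′ j e₀) m)) a (bs⊆es y∈bs)
      prefix = take (suc (length as)) es
      prefix≡ : prefix ≡ as ++ R j e₀ ∷ []
      prefix≡ = take-length-++ as (R j e₀) bs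
      in-prefix : member prefix (L a) ≡ true
      in-prefix = proj₁ (prefixes (suc (length as))) (L a) (R j e₀)
        (∈⇒member prefix _ (subst (R j e₀ ∈_) (sym prefix≡) (∈-++⁺ʳ as (here refl)))) (trans (leq-LR a j e₀) a∈mc)
      L-a∈as : L a ∈ as
      L-a∈as with ∈-++⁻ as (member⇒∈ (as ++ R j e₀ ∷ []) (L a) (subst (λ z → member z (L a) ≡ true) prefix≡ in-prefix))
      ... | inj₁ m = m
      ... | inj₂ (here q) = ⊥-elim (L≢R q)

  realises-⨾ : ∀ {C₁ C₂ : Cmd Act} → Realises C₁ P₁ → Realises C₂ P₂ → Realises (C₁ ⨾ C₂) P
  realises-⨾ real₁ real₂ xs chain with split-at-first-R xs
  ... | inj₁ all-L = ⊥-elim (chain-leaves-P₁ real₂ _ (subst (MaximalChain P) (Left.map-emb-mapMaybe xs all-L) chain))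
  ... | inj₂ (as , j , e₀ , bs , refl , as-L) =
    subst (λ z → Run _ (val P (toSubset z)) (map (lab P) z)) (sym es≡) (Run-split real₁ real₂ (subst (MaximalChain P) es≡ chain))
    where
    open Split j (mapMaybe projˡ as) e₀ (mapMaybe (projʳ j) bs) using (es; Run-split)
    es≡ : as ++ R j e₀ ∷ bs ≡ es
    es≡ = cong₂ (λ xs ys → xs ++ R j e₀ ∷ ys) (Left.map-emb-mapMaybe as as-L)
      (Right.map-emb-mapMaybe j bs (All.tabulate (AfterFirstR.after-first-R as j e₀ bs chain)))

realises-single : ∀ {C : Cmd Act} {l} → C ⟶ ((1ℚ , l , ✓) ∷ []) → Realises C (single l)
realises-single s [] (_ , _ , (_ , mx)) =
  absurdᵇ (mx (λ _ → true) ((λ _ _ _ _ → refl) , (λ _ _ _ _ → refl)) (λ _ _ → refl) zero refl) (member-[] {1} zero)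
realises-single s (zero ∷ []) _ = halt s
realises-single s (zero ∷ zero ∷ _) ((zero≢zero ∷ _) ∷ _ , _) = ⊥-elim (zero≢zero refl)

realises : (C : Cmd Act) → Realises C ⟦ C ⟧
realises skip = realises-single skip-step
realises (act a) = realises-single act-step
realises (C₁ ⨾ C₂) = Sequential.realises-⨾ (seqEncoding ⟦ C₁ ⟧ ⟦ C₂ ⟧) (realises C₁) (realises C₂)
realises (choice C₁ p _ _ C₂) = Choice.realises-choice p ⟦ C₁ ⟧ ⟦ C₂ ⟧ (realises C₁) (realises C₂)
realises (C₁ ∥ C₂) = Parallel.realises-∥ ⟦ C₁ ⟧ ⟦ C₂ ⟧ (realises C₁) (realises C₂)

mainTheorem4 : {Act : Set} (C : Cmd Act) (x₀ : Subset (size ⟦ C ⟧)) →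
    IsMaximal ⟦ C ⟧ x₀ →
    (es : List (Fin (size ⟦ C ⟧))) → CoveringChain ⟦ C ⟧ x₀ es →
    Σ (Dist Act (Word Act)) λ d → (C ↠ d) ×
      Σ (Dist Act (Word Act)) λ rest →
        d ↭ ((val ⟦ C ⟧ x₀ , map (lab ⟦ C ⟧) es , ✓) ∷ rest)
mainTheorem4 C x₀ maximal es (unique , prefixes , refl) with Run⇒↠ (realises C es chain)
  where
  chain : MaximalChain ⟦ C ⟧ es
  chain = unique , (λ i → IsConfig→Config ⟦ C ⟧ (toSubset (take i es)) (prefixes i)) , IsMaximal→Maximal ⟦ C ⟧ (toSubset es) maximal
... | d , C↠d , atom∈d = d , C↠d , ∈⇒↭-∷ atom∈d
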